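{- Let $p$ be a prime, let $\ell$ be a prime different from $p$, let $a\geq 1$, and let $m=\ell^a$. Assume that the cyclotomic polynomial $\Phi_m(X)\in\mathbb{Z}[X]$ remains irreducible modulo $p$. Then $W_p(m)=\mathbb{N}p+\mathbb{N}\ell=\{bp+c\ell: b,c\in\mathbb{N}\}$, where $\mathbb{N}=\{0,1,2,\dots\}$.
   Context: For a prime $p$ and a positive integer $m$, $W_p(m)$ denotes the set of integers $n\geq 0$ for which there exist $\alpha_1,\dots,\alpha_n\in\overline{\mathbb{F}}_p$ with $\alpha_i^m=1$ for all $i$ (repetitions allowed) and $\alpha_1+\cdots+\alpha_n=0$ (so $0\in W_p(m)$). -}

module Defs where

open import Level using (Level; _⊔_)
open import Algebra.Bundles using (CommutativeRing)
open import Data.Nat as ℕ using (ℕ; zero; suc; _≤_; ∣_-_∣)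
open import Data.Nat.Divisibility using (_∣_)
open import Data.List using (List; []; _∷_; _++_; [_]; map; replicate; upTo)
open import Data.Nat.ListAction using (sum)
open import Data.Fin using (Fin)
import Data.Fin as Fin
open import Data.Product using (Σ; ∃; _×_; _,_)
open import Relation.Nullary using (¬_)

record Field (c ℓ : Level) : Set (Level.suc (c ⊔ ℓ)) where
  field
    commutativeRing : CommutativeRing c ℓ
  open CommutativeRing commutativeRing public
  field
    0≉1     : ¬ (0# ≈ 1#)
    inverse : ∀ x → ¬ (x ≈ 0#) → ∃ λ y → x * y ≈ 1#

module FieldOps {c ℓ : Level} (K : Field c ℓ) where
  open Field K

  pow : Carrier → ℕ → Carrier
  pow x zero    = 1#
  pow x (suc n) = x * pow x n

  natCast : ℕ → Carrier
  natCast zero    = 0#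
  natCast (suc n) = 1# + natCast n

  sumF : (n : ℕ) → (Fin n → Carrier) → Carrier
  sumF zero    α = 0#
  sumF (suc n) α = α Fin.zero + sumF n (λ i → α (Fin.suc i))

  eval : List Carrier → Carrier → Carrier
  eval []       x = 0#
  eval (c ∷ cs) x = c + x * eval cs x

-- K is an algebraic closure of F_p: K has characteristic p (p · 1 = 0),
-- every element of K is algebraic over the prime field F_p (root of a
-- monic polynomial with coefficients in F_p), and K is algebraically
-- closed (every monic polynomial of degree ≥ 1 over K has a root in K).
record IsAlgebraicClosureOfFp {c ℓ : Level} (p : ℕ) (K : Field c ℓ) : Set (c ⊔ ℓ) where
  open Field K
  open FieldOps K
  field
    characteristic : natCast p ≈ 0#
    algebraic      : ∀ x → ∃ λ (cs : List ℕ) → eval (map natCast cs ++ [ 1# ]) x ≈ 0#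
    algClosed      : ∀ (c₀ : Carrier) (cs : List Carrier) → ∃ λ x → eval (c₀ ∷ cs ++ [ 1# ]) x ≈ 0#

InW : {c ℓ : Level} (K : Field c ℓ) (m n : ℕ) → Set (c ⊔ ℓ)
InW K m n = ∃ λ (α : Fin n → Carrier) → (∀ i → pow (α i) m ≈ 1#) × (sumF n α ≈ 0#)
  where open Field K
        open FieldOps K

-- Polynomials with natural-number coefficients (constant term first),
-- read in Z[X] or reduced into F_p[X].

coeff : List ℕ → ℕ → ℕ
coeff []       k       = 0
coeff (c ∷ cs) zero    = c
coeff (c ∷ cs) (suc k) = coeff cs k

mulCoeff : List ℕ → List ℕ → ℕ → ℕ
mulCoeff f g k = sum (map (λ i → coeff f i ℕ.* coeff g (k ℕ.∸ i)) (upTo (suc k)))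

_≡_[mod_] : ℕ → ℕ → ℕ → Set
x ≡ y [mod p ] = p ∣ ∣ x - y ∣

PosDegMod : ℕ → List ℕ → Set
PosDegMod p f = ∃ λ k → (1 ≤ k) × ¬ (p ∣ coeff f k)

IrreducibleMod : ℕ → List ℕ → Set
IrreducibleMod p f =
  PosDegMod p f ×
  ¬ (Σ (List ℕ) λ g → Σ (List ℕ) λ h →
       PosDegMod p g × PosDegMod p h × (∀ k → mulCoeff g h k ≡ coeff f k [mod p ]))

expand : ℕ → List ℕ → List ℕ
expand d []            = []
expand d (c ∷ [])      = c ∷ []
expand d (c ∷ c' ∷ cs) = c ∷ (replicate (d ℕ.∸ 1) 0 ++ expand d (c' ∷ cs))

-- The cyclotomic polynomial Φ_{ℓ^a}(X) ∈ Z[X] for ℓ prime, a ≥ 1: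
-- Φ_{ℓ^a}(X) = Φ_ℓ(X^{ℓ^{a-1}}) = Σ_{j<ℓ} X^{j·ℓ^{a-1}}.
cyclotomicPrimePower : ℕ → ℕ → List ℕ
cyclotomicPrimePower ℓ a = expand (ℓ ℕ.^ (a ℕ.∸ 1)) (replicate ℓ 1)

-- Let d = l^(a−1), m = l^a, η ≠ 1 a root of 1 + X + ⋯ + X^(l−1) and ζ a root of X^d − η.
-- Then ζ is a primitive m-th root of unity, so every m-th root of unity is a power of ζ,
-- and a vanishing sum of n of them reads Σ_{k<m} N_k ζ^k = 0 with Σ_k N_k = n.  As
-- Φ_m(X) = Σ_{t<l} X^(td) is irreducible mod p, it is the minimal polynomial of ζ over 𝔽_p,
-- so 1, ζ, …, ζ^(D−1) with D = (l−1)d are linearly independent over 𝔽_p.  Rewriting the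
-- relation with ζ^(D+r) = −Σ_{t<l−1} ζ^(td+r) and comparing coefficients gives
-- N_(td+r) ≡ N_(D+r) (mod p) for every t < l, hence n = Σ_{r<d} Σ_{t<l} N_(td+r) ∈ ℕp + ℕl.
-- Conversely, p copies of 1 and the l powers of η are vanishing sums of lengths p and l.

module Submission where

open import Defs
open import Level using (Level; _⊔_)
open import Algebra.Bundles using (CommutativeSemiring)
open import Data.Empty using (⊥-elim)
open import Data.Fin using (Fin)
import Data.Fin as Fin
open import Data.List using (List; []; _∷_; _++_; [_]; map; replicate; upTo; applyUpTo; length)
import Data.List.Properties as Listₚ
open import Data.List.Relation.Unary.All using (All; []; _∷_)
open import Data.Nat as ℕ using (ℕ; zero; suc; _≤_; _<_; _∸_; z≤n; s≤s; NonZero)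
import Data.Nat.Properties as ℕₚ
open import Data.Nat.Coprimality as Coprimality using (Coprime; coprime-Bézout; coprime-divisor)
open import Data.Nat.DivMod using (_%_; _/_; %-remove-+ʳ; m≡m%n+[m/n]*n; [m+kn]%n≡m%n; m<n⇒m%n≡m)
open import Data.Nat.Divisibility using (_∣_; divides; _∣?_; ∣⇒≤; ∣1⇒≡1; *-cancelʳ-∣; *-monoˡ-∣)
open import Data.Nat.GCD using (module Bézout; module GCD)
open import Data.Nat.ListAction using (sum)
open import Data.Nat.Primality using (Prime; prime⇒irreducible; prime⇒nonZero; prime⇒nonTrivial; euclidsLemma)
open import Data.Product using (∃; ∃₂; Σ; _×_; _,_; proj₁; proj₂)
open import Data.Sum using (_⊎_; inj₁; inj₂)
open import Data.Sum.Properties using ([,]-map)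
open import Data.Vec.Functional using () renaming (_++_ to _++ᵛ_)
open import Function using (_∘_)
open import Function.Bundles using (_⇔_; mk⇔)
open import Relation.Binary.Definitions using (tri<; tri≈; tri>)
open import Relation.Binary.PropositionalEquality as ≡ using (_≡_; _≢_)
open import Relation.Nullary using (¬_; yes; no; Dec)
open import Relation.Nullary.Decidable using (map′; decidable-stable)

module Sums {a ℓ} (S : CommutativeSemiring a ℓ) where
  open CommutativeSemiring S
  open import Relation.Binary.Reasoning.Setoid setoid
  open import Algebra.Properties.CommutativeSemigroup +-commutativeSemigroup using (interchange)

  ∑< : ℕ → (ℕ → Carrier) → Carrier
  ∑< zero    f = 0#
  ∑< (suc n) f = ∑< n f + f n

  syntax ∑< n (λ i → e) = ∑[ i < n ] e

  ∑-cong : ∀ n {f g} → (∀ i → i < n → f i ≈ g i) → ∑< n f ≈ ∑< n g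
  ∑-cong zero    f≈g = refl
  ∑-cong (suc n) f≈g = +-cong (∑-cong n (λ i i<n → f≈g i (ℕₚ.m≤n⇒m≤1+n i<n))) (f≈g n ℕₚ.≤-refl)

  ∑-zero : ∀ n {f} → (∀ i → i < n → f i ≈ 0#) → ∑< n f ≈ 0#
  ∑-zero zero    f≈0 = refl
  ∑-zero (suc n) f≈0 =
    trans (+-cong (∑-zero n (λ i i<n → f≈0 i (ℕₚ.m≤n⇒m≤1+n i<n))) (f≈0 n ℕₚ.≤-refl)) (+-identityʳ 0#)

  ∑-distrib-+ : ∀ n f g → ∑[ i < n ] (f i + g i) ≈ ∑< n f + ∑< n g
  ∑-distrib-+ zero    f g = sym (+-identityʳ 0#)
  ∑-distrib-+ (suc n) f g = trans (+-congʳ (∑-distrib-+ n f g)) (interchange _ _ _ _)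

  *-distribˡ-∑ : ∀ n x f → x * ∑< n f ≈ ∑[ i < n ] (x * f i)
  *-distribˡ-∑ zero    x f = zeroʳ x
  *-distribˡ-∑ (suc n) x f = trans (distribˡ x _ _) (+-congʳ (*-distribˡ-∑ n x f))

  *-distribʳ-∑ : ∀ n x f → ∑< n f * x ≈ ∑[ i < n ] (f i * x)
  *-distribʳ-∑ n x f = trans (*-comm _ x) (trans (*-distribˡ-∑ n x f) (∑-cong n (λ i _ → *-comm x (f i))))

  ∑-comm : ∀ m n (f : ℕ → ℕ → Carrier) → ∑[ i < m ] ∑[ j < n ] f i j ≈ ∑[ j < n ] ∑[ i < m ] f i j
  ∑-comm zero    n f = sym (∑-zero n (λ _ _ → refl))
  ∑-comm (suc m) n f = begin
    ∑[ i < m ] ∑[ j < n ] f i j + ∑[ j < n ] f m j  ≈⟨ +-congʳ (∑-comm m n f) ⟩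
    ∑[ j < n ] ∑[ i < m ] f i j + ∑[ j < n ] f m j  ≈⟨ ∑-distrib-+ n _ (f m) ⟨
    ∑[ j < n ] ∑[ i < suc m ] f i j                 ∎

  ∑-suc : ∀ n f → ∑< (suc n) f ≈ f 0 + ∑[ i < n ] f (suc i)
  ∑-suc zero    f = trans (+-identityˡ _) (sym (+-identityʳ _))
  ∑-suc (suc n) f = trans (+-congʳ (∑-suc n f)) (+-assoc _ _ _)

  ∑-+ : ∀ m n f → ∑< (m ℕ.+ n) f ≈ ∑< m f + ∑[ i < n ] f (m ℕ.+ i)
  ∑-+ m zero    f = trans (reflexive (≡.cong (λ k → ∑< k f) (ℕₚ.+-identityʳ m))) (sym (+-identityʳ _))
  ∑-+ m (suc n) f = begin
    ∑< (m ℕ.+ suc n) f                                ≡⟨ ≡.cong (λ k → ∑< k f) (ℕₚ.+-suc m n) ⟩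
    ∑< (m ℕ.+ n) f + f (m ℕ.+ n)                        ≈⟨ +-congʳ (∑-+ m n f) ⟩
    (∑< m f + ∑[ i < n ] f (m ℕ.+ i)) + f (m ℕ.+ n)     ≈⟨ +-assoc _ _ _ ⟩
    ∑< m f + ∑[ i < suc n ] f (m ℕ.+ i)               ∎

  ∑-* : ∀ n d f → ∑< (n ℕ.* d) f ≈ ∑[ t < n ] ∑[ r < d ] f (t ℕ.* d ℕ.+ r)
  ∑-* zero    d f = refl
  ∑-* (suc n) d f = begin
    ∑< (d ℕ.+ n ℕ.* d) f                                ≡⟨ ≡.cong (λ k → ∑< k f) (ℕₚ.+-comm d (n ℕ.* d)) ⟩
    ∑< (n ℕ.* d ℕ.+ d) f                                ≈⟨ ∑-+ (n ℕ.* d) d f ⟩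
    ∑< (n ℕ.* d) f + ∑[ r < d ] f (n ℕ.* d ℕ.+ r)         ≈⟨ +-congʳ (∑-* n d f) ⟩
    ∑[ t < suc n ] ∑[ r < d ] f (t ℕ.* d ℕ.+ r)         ∎

  ∑-single : ∀ n s {f} → s < n → (∀ i → i < n → i ≢ s → f i ≈ 0#) → ∑< n f ≈ f s
  ∑-single (suc n) s s<1+n f≈0 with ℕₚ.m≤n⇒m<n∨m≡n (ℕₚ.≤-pred s<1+n)
  ... | inj₁ s<n    = trans (+-cong (∑-single n s s<n (λ i i<n → f≈0 i (ℕₚ.m≤n⇒m≤1+n i<n)))
                                    (f≈0 n ℕₚ.≤-refl (ℕₚ.>⇒≢ s<n)))
                            (+-identityʳ _)
  ... | inj₂ ≡.refl =
    trans (+-congʳ (∑-zero n (λ i i<n → f≈0 i (ℕₚ.m≤n⇒m≤1+n i<n) (ℕₚ.<⇒≢ i<n)))) (+-identityˡ _)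

module ℕ∑ = Sums ℕₚ.+-*-commutativeSemiring

prime∤⇒coprime : ∀ {p a} → Prime p → ¬ p ∣ a → Coprime p a
prime∤⇒coprime p-prime p∤a (i∣p , i∣a) with prime⇒irreducible p-prime i∣p
... | inj₁ i≡1     = i≡1
... | inj₂ ≡.refl = ⊥-elim (p∤a i∣a)

prime>1 : ∀ {p} → Prime p → 1 < p
prime>1 {p} p-prime = ℕ.nonTrivial⇒n>1 p {{prime⇒nonTrivial p-prime}}

prime∤prime : ∀ {p l} → Prime p → Prime l → p ≢ l → ¬ p ∣ l
prime∤prime p-prime l-prime p≢l p∣l with prime⇒irreducible l-prime p∣l
... | inj₁ ≡.refl = ℕₚ.<-irrefl ≡.refl (prime>1 p-prime)
... | inj₂ p≡l    = p≢l p≡l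

prime∣^⇒∣ : ∀ {p l} → Prime p → ∀ a → p ∣ l ℕ.^ a → p ∣ l
prime∣^⇒∣ p-prime zero    p∣1 = ⊥-elim (ℕₚ.<-irrefl (≡.sym (∣1⇒≡1 p∣1)) (prime>1 p-prime))
prime∣^⇒∣ {l = l} p-prime (suc a) p∣lˡᵃ with euclidsLemma l (l ℕ.^ a) p-prime p∣lˡᵃ
... | inj₁ p∣l  = p∣l
... | inj₂ p∣lᵃ = prime∣^⇒∣ p-prime a p∣lᵃ

divisor-of-prime-power : ∀ {l} → Prime l → ∀ b {g} →
                         g ∣ l ℕ.^ suc b → g ∣ l ℕ.^ b ⊎ g ≡ l ℕ.^ suc b
divisor-of-prime-power {l} l-prime b {g} g∣lᵇ⁺¹ with l ∣? g
... | no  l∤g = inj₁ (coprime-divisor (Coprimality.sym (prime∤⇒coprime l-prime l∤g)) g∣lᵇ⁺¹)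
... | yes (divides q ≡.refl) =
  multiple-of-l b q (*-cancelʳ-∣ l (≡.subst (q ℕ.* l ∣_) (ℕₚ.*-comm l _) g∣lᵇ⁺¹))
  where
  instance
    l≢0 : NonZero l
    l≢0 = prime⇒nonZero l-prime
  multiple-of-l : ∀ b q → q ∣ l ℕ.^ b → q ℕ.* l ∣ l ℕ.^ b ⊎ q ℕ.* l ≡ l ℕ.^ suc b
  multiple-of-l zero    q q∣1 = inj₂ (≡.trans (≡.cong (ℕ._* l) (∣1⇒≡1 q∣1)) (ℕₚ.*-comm 1 l))
  multiple-of-l (suc b) q q∣lᵇ⁺¹ with divisor-of-prime-power l-prime b q∣lᵇ⁺¹
  ... | inj₁ q∣lᵇ    = inj₁ (≡.subst (q ℕ.* l ∣_) (ℕₚ.*-comm (l ℕ.^ b) l) (*-monoˡ-∣ l q∣lᵇ))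
  ... | inj₂ ≡.refl = inj₂ (ℕₚ.*-comm (l ℕ.^ suc b) l)

module Multiplicities where
  open import Data.Nat using (_+_; _*_)
  open ℕ∑
  open ≡.≡-Reasoning

  δ : ℕ → ℕ → ℕ
  δ i j with i ℕ.≟ j
  ... | yes _ = 1
  ... | no  _ = 0

  δ-refl : ∀ i → δ i i ≡ 1
  δ-refl i with i ℕ.≟ i
  ... | yes _   = ≡.refl
  ... | no  i≢i = ⊥-elim (i≢i ≡.refl)

  δ-≢ : ∀ {i j} → i ≢ j → δ i j ≡ 0
  δ-≢ {i} {j} i≢j with i ℕ.≟ j
  ... | yes i≡j = ⊥-elim (i≢j i≡j)
  ... | no  _   = ≡.refl

  multiplicity : List ℕ → ℕ → ℕ
  multiplicity []       k = 0
  multiplicity (j ∷ js) k = δ k j + multiplicity js k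

  length≡∑multiplicity : ∀ n js → All (_< n) js → length js ≡ ∑[ k < n ] multiplicity js k
  length≡∑multiplicity n []       []           = ≡.sym (∑-zero n (λ _ _ → ≡.refl))
  length≡∑multiplicity n (j ∷ js) (j<n ∷ js<n) = begin
    1 + length js
      ≡⟨ ≡.cong₂ _+_ (≡.sym ∑δ≡1) (length≡∑multiplicity n js js<n) ⟩
    ∑[ k < n ] δ k j + ∑[ k < n ] multiplicity js k
      ≡⟨ ∑-distrib-+ n (λ k → δ k j) (multiplicity js) ⟨
    ∑[ k < n ] multiplicity (j ∷ js) k
      ∎
    where
    ∑δ≡1 : ∑[ k < n ] δ k j ≡ 1
    ∑δ≡1 = ≡.trans (∑-single n j j<n (λ _ _ → δ-≢)) (δ-refl j)

module BlockSums where
  open import Data.Nat using (_+_; _*_)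
  open ℕ∑
  open ≡.≡-Reasoning

  [t*d+r]%d≡r : ∀ t {d r} .{{_ : NonZero d}} → r < d → (t * d + r) % d ≡ r
  [t*d+r]%d≡r t {d} {r} r<d = begin
    (t * d + r) % d  ≡⟨ ≡.cong (_% d) (ℕₚ.+-comm (t * d) r) ⟩
    (r + t * d) % d  ≡⟨ [m+kn]%n≡m%n r t d ⟩
    r % d            ≡⟨ m<n⇒m%n≡m r<d ⟩
    r                ∎

  ∑-const : ∀ n x → ∑[ i < n ] x ≡ n * x
  ∑-const zero    x = ≡.refl
  ∑-const (suc n) x = ≡.trans (≡.cong (_+ x) (∑-const n x)) (ℕₚ.+-comm (n * x) x)

  ∑-blockwise-congruent : ∀ {p} .{{_ : NonZero p}} l d (N C : ℕ → ℕ) →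
                          (∀ t r → t < l → r < d → N (t * d + r) % p ≡ C r) →
                          ∃₂ λ b c → ∑[ k < l * d ] N k ≡ b * p + c * l
  ∑-blockwise-congruent {p} l d N C N≡C = b , ∑< d C , (begin
    ∑[ k < l * d ] N k
      ≡⟨ ∑-* l d N ⟩
    ∑[ t < l ] ∑[ r < d ] N (t * d + r)
      ≡⟨ ∑-cong l (λ t t<l → ∑-cong d (λ r r<d → split t r t<l r<d)) ⟩
    ∑[ t < l ] ∑[ r < d ] (C r + Q t r * p)
      ≡⟨ ∑-cong l (λ t _ → ∑-distrib-+ d C (λ r → Q t r * p)) ⟩
    ∑[ t < l ] (∑< d C + ∑[ r < d ] (Q t r * p))
      ≡⟨ ∑-distrib-+ l (λ _ → ∑< d C) _ ⟩
    ∑[ t < l ] ∑< d C + ∑[ t < l ] ∑[ r < d ] (Q t r * p)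
      ≡⟨ ≡.cong₂ _+_ (∑-const l (∑< d C)) multiple-of-p ⟩
    l * ∑< d C + b * p
      ≡⟨ ≡.cong₂ _+_ (ℕₚ.*-comm l _) ≡.refl ⟩
    ∑< d C * l + b * p
      ≡⟨ ℕₚ.+-comm _ (b * p) ⟩
    b * p + ∑< d C * l
      ∎)
    where
    Q : ℕ → ℕ → ℕ
    Q t r = N (t * d + r) / p
    b : ℕ
    b = ∑[ t < l ] ∑< d (Q t)
    split : ∀ t r → t < l → r < d → N (t * d + r) ≡ C r + Q t r * p
    split t r t<l r<d = ≡.trans (m≡m%n+[m/n]*n (N (t * d + r)) p) (≡.cong (_+ Q t r * p) (N≡C t r t<l r<d))
    multiple-of-p : ∑[ t < l ] ∑[ r < d ] (Q t r * p) ≡ b * p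
    multiple-of-p = ≡.trans (∑-cong l (λ t _ → ≡.sym (*-distribʳ-∑ d p (Q t)))) (≡.sym (*-distribʳ-∑ l p _))

∈ℕp+ℕl? : ∀ p l n .{{_ : NonZero p}} .{{_ : NonZero l}} → Dec (∃₂ λ b c → n ≡ b ℕ.* p ℕ.+ c ℕ.* l)
∈ℕp+ℕl? p l n = map′ (λ { (b , _ , c , _ , n≡bp+cl) → b , c , n≡bp+cl }) bounded
  (ℕₚ.anyUpTo? (λ b → ℕₚ.anyUpTo? (λ c → n ℕ.≟ b ℕ.* p ℕ.+ c ℕ.* l) (suc n)) (suc n))
  where
  bounded : (∃₂ λ b c → n ≡ b ℕ.* p ℕ.+ c ℕ.* l) →
            ∃ λ b → b < suc n × ∃ λ c → c < suc n × n ≡ b ℕ.* p ℕ.+ c ℕ.* l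
  bounded (b , c , n≡bp+cl) = b , s≤s b≤n , c , s≤s c≤n , n≡bp+cl
    where
    b≤n : b ≤ n
    b≤n = ℕₚ.≤-trans (ℕₚ.m≤m*n b p) (ℕₚ.≤-trans (ℕₚ.m≤m+n _ _) (ℕₚ.≤-reflexive (≡.sym n≡bp+cl)))
    c≤n : c ≤ n
    c≤n = ℕₚ.≤-trans (ℕₚ.m≤m*n c l) (ℕₚ.≤-trans (ℕₚ.m≤n+m _ _) (ℕₚ.≤-reflexive (≡.sym n≡bp+cl)))

module CoefficientLists where
  open import Data.Nat using (_+_; _*_)
  open ℕ∑
  open ≡.≡-Reasoning

  infixl 6 _⊕_
  _⊕_ : List ℕ → List ℕ → List ℕ
  []      ⊕ g       = g
  (a ∷ f) ⊕ []      = a ∷ f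
  (a ∷ f) ⊕ (b ∷ g) = a + b ∷ f ⊕ g

  coeff-⊕ : ∀ f g k → coeff (f ⊕ g) k ≡ coeff f k + coeff g k
  coeff-⊕ []      g       k       = ≡.refl
  coeff-⊕ (a ∷ f) []      k       = ≡.sym (ℕₚ.+-identityʳ _)
  coeff-⊕ (a ∷ f) (b ∷ g) zero    = ≡.refl
  coeff-⊕ (a ∷ f) (b ∷ g) (suc k) = coeff-⊕ f g k

  scale : ℕ → List ℕ → List ℕ
  scale a = map (a *_)

  coeff-scale : ∀ a g k → coeff (scale a g) k ≡ a * coeff g k
  coeff-scale a []      k       = ≡.sym (ℕₚ.*-zeroʳ a)
  coeff-scale a (b ∷ g) zero    = ≡.refl
  coeff-scale a (b ∷ g) (suc k) = coeff-scale a g k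

  shift : ℕ → List ℕ → List ℕ
  shift s g = replicate s 0 ++ g

  coeff-shift-< : ∀ s g {k} → k < s → coeff (shift s g) k ≡ 0
  coeff-shift-< (suc s) g {zero}  _         = ≡.refl
  coeff-shift-< (suc s) g {suc k} (s≤s k<s) = coeff-shift-< s g k<s

  coeff-shift-+ : ∀ s g k → coeff (shift s g) (s + k) ≡ coeff g k
  coeff-shift-+ zero    g k = ≡.refl
  coeff-shift-+ (suc s) g k = coeff-shift-+ s g k

  coeff-shift-≥ : ∀ s g {k} → s ≤ k → coeff (shift s g) k ≡ coeff g (k ∸ s)
  coeff-shift-≥ s g {k} s≤k = begin
    coeff (shift s g) k             ≡⟨ ≡.cong (coeff (shift s g)) (ℕₚ.m+[n∸m]≡n s≤k) ⟨
    coeff (shift s g) (s + (k ∸ s)) ≡⟨ coeff-shift-+ s g (k ∸ s) ⟩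
    coeff g (k ∸ s)                 ∎

  monomial : ℕ → ℕ → List ℕ
  monomial s a = shift s [ a ]

  coeff-monomial-≡ : ∀ s a → coeff (monomial s a) s ≡ a
  coeff-monomial-≡ s a = ≡.trans (≡.cong (coeff (monomial s a)) (≡.sym (ℕₚ.+-identityʳ s))) (coeff-shift-+ s [ a ] 0)

  coeff-monomial-≢ : ∀ s a {i} → i ≢ s → coeff (monomial s a) i ≡ 0
  coeff-monomial-≢ s a {i} i≢s with ℕₚ.<-cmp i s
  ... | tri< i<s _   _   = coeff-shift-< s [ a ] i<s
  ... | tri≈ _   i≡s _   = ⊥-elim (i≢s i≡s)
  ... | tri> _   _   s<i = ≡.trans (coeff-shift-≥ s [ a ] (ℕₚ.<⇒≤ s<i)) (coeff-singleton (ℕₚ.m<n⇒0<n∸m s<i))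
    where
    coeff-singleton : ∀ {j} → 0 < j → coeff [ a ] j ≡ 0
    coeff-singleton {suc j} _ = ≡.refl

  coeff-applyUpTo-< : ∀ F n {k} → k < n → coeff (applyUpTo F n) k ≡ F k
  coeff-applyUpTo-< F (suc n) {zero}  _         = ≡.refl
  coeff-applyUpTo-< F (suc n) {suc k} (s≤s k<n) = coeff-applyUpTo-< (F ∘ suc) n k<n

  coeff-applyUpTo-≥ : ∀ F n {k} → n ≤ k → coeff (applyUpTo F n) k ≡ 0
  coeff-applyUpTo-≥ F zero    _         = ≡.refl
  coeff-applyUpTo-≥ F (suc n) (s≤s n≤k) = coeff-applyUpTo-≥ (F ∘ suc) n n≤k

  sum-map-upTo : ∀ n F → sum (map F (upTo n)) ≡ ∑< n F
  sum-map-upTo n F = ≡.trans (≡.cong sum (Listₚ.map-applyUpTo (λ i → i) F n)) (sum-applyUpTo n F)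
    where
    sum-applyUpTo : ∀ n F → sum (applyUpTo F n) ≡ ∑< n F
    sum-applyUpTo zero    F = ≡.refl
    sum-applyUpTo (suc n) F = ≡.trans (≡.cong (F 0 +_) (sum-applyUpTo n (F ∘ suc))) (≡.sym (∑-suc n F))

  mulCoeff-∑ : ∀ f g k → mulCoeff f g k ≡ ∑[ i < suc k ] (coeff f i * coeff g (k ∸ i))
  mulCoeff-∑ f g k = sum-map-upTo (suc k) _

  mulCoeff-[] : ∀ g k → mulCoeff [] g k ≡ 0
  mulCoeff-[] g k = ≡.trans (mulCoeff-∑ [] g k) (∑-zero (suc k) (λ _ _ → ≡.refl))

  mulCoeff-⊕ : ∀ f f′ g k → mulCoeff (f ⊕ f′) g k ≡ mulCoeff f g k + mulCoeff f′ g k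
  mulCoeff-⊕ f f′ g k = begin
    mulCoeff (f ⊕ f′) g k
      ≡⟨ mulCoeff-∑ (f ⊕ f′) g k ⟩
    ∑[ i < suc k ] (coeff (f ⊕ f′) i * coeff g (k ∸ i))
      ≡⟨ ∑-cong (suc k) (λ i _ → ≡.trans (≡.cong (_* coeff g (k ∸ i)) (coeff-⊕ f f′ i))
                                          (ℕₚ.*-distribʳ-+ (coeff g (k ∸ i)) (coeff f i) _)) ⟩
    ∑[ i < suc k ] (coeff f i * coeff g (k ∸ i) + coeff f′ i * coeff g (k ∸ i))
      ≡⟨ ∑-distrib-+ (suc k) _ _ ⟩
    ∑[ i < suc k ] (coeff f i * coeff g (k ∸ i)) + ∑[ i < suc k ] (coeff f′ i * coeff g (k ∸ i))
      ≡⟨ ≡.cong₂ _+_ (mulCoeff-∑ f g k) (mulCoeff-∑ f′ g k) ⟨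
    mulCoeff f g k + mulCoeff f′ g k
      ∎

  mulCoeff-monomial : ∀ s a g k → mulCoeff (monomial s a) g k ≡ a * coeff (shift s g) k
  mulCoeff-monomial s a g k with s ℕₚ.≤? k
  ... | yes s≤k = begin
    mulCoeff (monomial s a) g k                              ≡⟨ mulCoeff-∑ (monomial s a) g k ⟩
    ∑[ i < suc k ] (coeff (monomial s a) i * coeff g (k ∸ i)) ≡⟨ ∑-single (suc k) s (s≤s s≤k) other-terms ⟩
    coeff (monomial s a) s * coeff g (k ∸ s)                 ≡⟨ ≡.cong (_* coeff g (k ∸ s)) (coeff-monomial-≡ s a) ⟩
    a * coeff g (k ∸ s)                                      ≡⟨ ≡.cong (a *_) (coeff-shift-≥ s g s≤k) ⟨
    a * coeff (shift s g) k                                  ∎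
    where
    other-terms : ∀ i → i < suc k → i ≢ s → coeff (monomial s a) i * coeff g (k ∸ i) ≡ 0
    other-terms i _ i≢s = ≡.cong (_* coeff g (k ∸ i)) (coeff-monomial-≢ s a i≢s)
  ... | no s≰k = begin
    mulCoeff (monomial s a) g k
      ≡⟨ mulCoeff-∑ (monomial s a) g k ⟩
    ∑[ i < suc k ] (coeff (monomial s a) i * coeff g (k ∸ i))
      ≡⟨ ∑-zero (suc k) (λ i i≤k → ≡.cong (_* coeff g (k ∸ i))
                                          (coeff-monomial-≢ s a (λ { ≡.refl → s≰k (ℕₚ.≤-pred i≤k) }))) ⟩
    0
      ≡⟨ ℕₚ.*-zeroʳ a ⟨
    a * 0
      ≡⟨ ≡.cong (a *_) (coeff-shift-< s g (ℕₚ.≰⇒> s≰k)) ⟨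
    a * coeff (shift s g) k
      ∎

  coeff-expand-top : ∀ e n → coeff (expand (suc e) (replicate (suc n) 1)) (n * suc e) ≡ 1
  coeff-expand-top e zero    = ≡.refl
  coeff-expand-top e (suc n) = ≡.trans (coeff-shift-+ e _ (n * suc e)) (coeff-expand-top e n)

  coeff-expand-high : ∀ e n {k} → n * suc e < k → coeff (expand (suc e) (replicate (suc n) 1)) k ≡ 0
  coeff-expand-high e zero    {suc k} _         = ≡.refl
  coeff-expand-high e (suc n) {suc k} (s≤s n+ne<k) =
    ≡.trans (coeff-shift-≥ e _ e≤k) (coeff-expand-high e n (ℕₚ.+-cancelˡ-< e _ _ n+ne<e+[k-e]))
    where
    e≤k : e ≤ k
    e≤k = ℕₚ.≤-trans (ℕₚ.m≤m+n e _) (ℕₚ.<⇒≤ n+ne<k)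
    n+ne<e+[k-e] : e + n * suc e < e + (k ∸ e)
    n+ne<e+[k-e] = ≡.subst (e + n * suc e <_) (≡.sym (ℕₚ.m+[n∸m]≡n e≤k)) n+ne<k

module FieldArithmetic {c ℓ} (K : Field c ℓ) where
  open Field K public hiding (zero)
  open FieldOps K public
  open import Algebra.Properties.Ring ring public
    using ( [y-z]x≈yx-zx; +-cancelʳ; +-identityˡ-unique; +-identityʳ-unique; +-inverseʳ-unique
          ; -‿involutive; x∙y⁻¹≈ε⇒x≈y)
  open import Algebra.Properties.CommutativeSemiring.Exp commutativeSemiring public
    using (_^_; ^-congˡ; ^-homo-*; ^-assocʳ; ^-distrib-*)
  open Sums commutativeSemiring public
  open import Relation.Binary.Reasoning.Setoid setoid

  natCast-homo-+ : ∀ m n → natCast (m ℕ.+ n) ≈ natCast m + natCast n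
  natCast-homo-+ zero    n = sym (+-identityˡ _)
  natCast-homo-+ (suc m) n = trans (+-congˡ (natCast-homo-+ m n)) (sym (+-assoc _ _ _))

  natCast-homo-* : ∀ m n → natCast (m ℕ.* n) ≈ natCast m * natCast n
  natCast-homo-* zero    n = sym (zeroˡ _)
  natCast-homo-* (suc m) n = begin
    natCast (n ℕ.+ m ℕ.* n)                      ≈⟨ natCast-homo-+ n (m ℕ.* n) ⟩
    natCast n + natCast (m ℕ.* n)                ≈⟨ +-cong (sym (*-identityˡ _)) (natCast-homo-* m n) ⟩
    1# * natCast n + natCast m * natCast n       ≈⟨ distribʳ _ _ _ ⟨
    (1# + natCast m) * natCast n                 ∎

  natCast-+-distribʳ : ∀ a b x → natCast (a ℕ.+ b) * x ≈ natCast a * x + natCast b * x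
  natCast-+-distribʳ a b x = trans (*-congʳ (natCast-homo-+ a b)) (distribʳ x _ _)

  natCast-∑ : ∀ n f → natCast (ℕ∑.∑< n f) ≈ ∑[ i < n ] natCast (f i)
  natCast-∑ zero    f = refl
  natCast-∑ (suc n) f = trans (natCast-homo-+ (ℕ∑.∑< n f) (f n)) (+-congʳ (natCast-∑ n f))

  pow≡^ : ∀ x n → pow x n ≡ x ^ n
  pow≡^ x zero    = ≡.refl
  pow≡^ x (suc n) = ≡.cong (x *_) (pow≡^ x n)

  sumF≈∑ : ∀ n (f : ℕ → Carrier) → sumF n (f ∘ Fin.toℕ) ≈ ∑< n f
  sumF≈∑ zero    f = refl
  sumF≈∑ (suc n) f = trans (+-congˡ (sumF≈∑ n (f ∘ suc))) (sym (∑-suc n f))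

  sumF-cong : ∀ n {f g : Fin n → Carrier} → (∀ i → f i ≈ g i) → sumF n f ≈ sumF n g
  sumF-cong zero    f≈g = refl
  sumF-cong (suc n) f≈g = +-cong (f≈g Fin.zero) (sumF-cong n (f≈g ∘ Fin.suc))

  sumF-++ : ∀ a b (f : Fin a → Carrier) (g : Fin b → Carrier) → sumF (a ℕ.+ b) (f ++ᵛ g) ≈ sumF a f + sumF b g
  sumF-++ zero    b f g = sym (+-identityˡ _)
  sumF-++ (suc a) b f g = begin
    f Fin.zero + sumF (a ℕ.+ b) ((f ++ᵛ g) ∘ Fin.suc)
      ≈⟨ +-congˡ (sumF-cong (a ℕ.+ b) (λ i → reflexive ([,]-map (Fin.splitAt a i)))) ⟩
    f Fin.zero + sumF (a ℕ.+ b) ((f ∘ Fin.suc) ++ᵛ g)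
      ≈⟨ +-congˡ (sumF-++ a b (f ∘ Fin.suc) g) ⟩
    f Fin.zero + (sumF a (f ∘ Fin.suc) + sumF b g)
      ≈⟨ +-assoc _ _ _ ⟨
    sumF (suc a) f + sumF b g
      ∎

  InW-+ : ∀ k {a b} → InW K k a → InW K k b → InW K k (a ℕ.+ b)
  InW-+ k {a} {b} (α , α-roots , ∑α≈0) (β , β-roots , ∑β≈0) =
    α ++ᵛ β , roots , trans (sumF-++ a b α β) (trans (+-cong ∑α≈0 ∑β≈0) (+-identityʳ 0#))
    where
    roots : ∀ i → pow ((α ++ᵛ β) i) k ≈ 1#
    roots i with Fin.splitAt a i
    ... | inj₁ j = α-roots j
    ... | inj₂ j = β-roots j

  InW-* : ∀ k {a} → InW K k a → ∀ b → InW K k (b ℕ.* a)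
  InW-* k a∈W zero    = (λ ()) , (λ ()) , refl
  InW-* k a∈W (suc b) = InW-+ k a∈W (InW-* k a∈W b)

  1^n≈1 : ∀ n → 1# ^ n ≈ 1#
  1^n≈1 zero    = refl
  1^n≈1 (suc n) = trans (*-identityˡ _) (1^n≈1 n)

  ^-comm : ∀ x i j → (x ^ i) ^ j ≈ (x ^ j) ^ i
  ^-comm x i j = begin
    (x ^ i) ^ j   ≈⟨ ^-assocʳ x i j ⟩
    x ^ (i ℕ.* j) ≡⟨ ≡.cong (x ^_) (ℕₚ.*-comm i j) ⟩
    x ^ (j ℕ.* i) ≈⟨ ^-assocʳ x j i ⟨
    (x ^ j) ^ i   ∎

  geo : Carrier → ℕ → Carrier
  geo x n = ∑[ i < n ] (x ^ i)

  geo-shift : ∀ x n → x * geo x n + 1# ≈ geo x (suc n)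
  geo-shift x n = begin
    x * geo x n + 1#                    ≈⟨ +-comm _ _ ⟩
    1# + x * geo x n                    ≈⟨ +-congˡ (*-distribˡ-∑ n x (x ^_)) ⟩
    1# + ∑[ i < n ] (x ^ suc i)         ≈⟨ ∑-suc n (x ^_) ⟨
    geo x (suc n)                       ∎

  geo-1 : ∀ n → geo 1# n ≈ natCast n
  geo-1 zero    = refl
  geo-1 (suc n) = trans (+-cong (geo-1 n) (1^n≈1 n)) (+-comm _ _)

  geo≈0⇒^≈1 : ∀ {x} n → geo x n ≈ 0# → x ^ n ≈ 1#
  geo≈0⇒^≈1 {x} n geo≈0 = begin
    x ^ n                   ≈⟨ +-identityˡ _ ⟨
    0# + x ^ n              ≈⟨ +-congʳ geo≈0 ⟨
    geo x (suc n)           ≈⟨ geo-shift x n ⟨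
    x * geo x n + 1#        ≈⟨ +-congʳ (trans (*-congˡ geo≈0) (zeroʳ x)) ⟩
    0# + 1#                 ≈⟨ +-identityˡ 1# ⟩
    1#                      ∎

  ^-*≈1 : ∀ {x} u k → x ^ k ≈ 1# → x ^ (u ℕ.* k) ≈ 1#
  ^-*≈1 {x} u k xᵏ≈1 = begin
    x ^ (u ℕ.* k)   ≡⟨ ≡.cong (x ^_) (ℕₚ.*-comm u k) ⟩
    x ^ (k ℕ.* u)   ≈⟨ ^-assocʳ x k u ⟨
    (x ^ k) ^ u     ≈⟨ ^-congˡ u xᵏ≈1 ⟩
    1# ^ u          ≈⟨ 1^n≈1 u ⟩
    1#              ∎

  ^-^≈1 : ∀ {x} i n → x ^ n ≈ 1# → (x ^ i) ^ n ≈ 1#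
  ^-^≈1 {x} i n xⁿ≈1 = trans (^-comm x i n) (trans (^-congˡ i xⁿ≈1) (1^n≈1 i))

  ^-+≈1 : ∀ {x} g w → x ^ w ≈ 1# → x ^ (g ℕ.+ w) ≈ 1# → x ^ g ≈ 1#
  ^-+≈1 {x} g w xʷ≈1 xᵍ⁺ʷ≈1 = begin
    x ^ g             ≈⟨ *-identityʳ _ ⟨
    x ^ g * 1#        ≈⟨ *-congˡ xʷ≈1 ⟨
    x ^ g * x ^ w     ≈⟨ ^-homo-* x g w ⟨
    x ^ (g ℕ.+ w)     ≈⟨ xᵍ⁺ʷ≈1 ⟩
    1#                ∎

  ^≈1-bézout : ∀ {x g k n} → x ^ k ≈ 1# → x ^ n ≈ 1# → Bézout.Identity g k n → x ^ g ≈ 1#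
  ^≈1-bézout {x} {g} {k} {n} xᵏ≈1 xⁿ≈1 (Bézout.+- u v g+vn≡uk) =
    ^-+≈1 g (v ℕ.* n) (^-*≈1 v n xⁿ≈1) (trans (reflexive (≡.cong (x ^_) g+vn≡uk)) (^-*≈1 u k xᵏ≈1))
  ^≈1-bézout {x} {g} {k} {n} xᵏ≈1 xⁿ≈1 (Bézout.-+ u v g+uk≡vn) =
    ^-+≈1 g (u ℕ.* k) (^-*≈1 u k xᵏ≈1) (trans (reflexive (≡.cong (x ^_) g+uk≡vn)) (^-*≈1 v n xⁿ≈1))

  x*y≈0⇒y≈0 : ∀ {x y} → ¬ x ≈ 0# → x * y ≈ 0# → y ≈ 0#
  x*y≈0⇒y≈0 {x} {y} x≉0 xy≈0 with inverse x x≉0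
  ... | x⁻¹ , xx⁻¹≈1 = begin
    y                ≈⟨ *-identityˡ y ⟨
    1# * y           ≈⟨ *-congʳ xx⁻¹≈1 ⟨
    (x * x⁻¹) * y    ≈⟨ *-congʳ (*-comm x x⁻¹) ⟩
    (x⁻¹ * x) * y    ≈⟨ *-assoc _ _ _ ⟩
    x⁻¹ * (x * y)    ≈⟨ *-congˡ xy≈0 ⟩
    x⁻¹ * 0#         ≈⟨ zeroʳ _ ⟩
    0#               ∎

  geo-vanish : ∀ {x} n → x ^ n ≈ 1# → ¬ x ≈ 1# → geo x n ≈ 0#
  geo-vanish {x} n xⁿ≈1 x≉1 = x*y≈0⇒y≈0 x-1≉0 (begin
    (x - 1#) * geo x n              ≈⟨ [y-z]x≈yx-zx (geo x n) x 1# ⟩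
    x * geo x n - 1# * geo x n      ≈⟨ +-cong x·geo≈geo (-‿cong (*-identityˡ _)) ⟩
    geo x n - geo x n               ≈⟨ -‿inverseʳ _ ⟩
    0#                              ∎)
    where
    x·geo≈geo : x * geo x n ≈ geo x n
    x·geo≈geo = +-cancelʳ 1# _ _ (trans (geo-shift x n) (+-congˡ xⁿ≈1))
    x-1≉0 : ¬ x - 1# ≈ 0#
    x-1≉0 x-1≈0 = x≉1 (x∙y⁻¹≈ε⇒x≈y x 1# x-1≈0)

module Characteristic {c ℓ} (K : Field c ℓ) {p} (p-prime : Prime p)
                      (char-p : Field._≈_ K (FieldOps.natCast K p) (Field.0# K)) where
  open FieldArithmetic K public
  open import Relation.Binary.Reasoning.Setoid setoid

  instance
    p≢0 : NonZero p
    p≢0 = prime⇒nonZero p-prime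

  natCast-*p : ∀ k → natCast (k ℕ.* p) ≈ 0#
  natCast-*p k = trans (natCast-homo-* k p) (trans (*-congˡ char-p) (zeroʳ _))

  p∣⇒natCast≈0 : ∀ {a} → p ∣ a → natCast a ≈ 0#
  p∣⇒natCast≈0 (divides k ≡.refl) = natCast-*p k

  natCast[p-1]+1≈0 : natCast (p ∸ 1) + 1# ≈ 0#
  natCast[p-1]+1≈0 = trans (+-comm _ 1#) (trans (reflexive (≡.cong natCast (ℕₚ.suc-pred p))) char-p)

  [p-1]y+y≈0 : ∀ y → natCast (p ∸ 1) * y + y ≈ 0#
  [p-1]y+y≈0 y = begin
    natCast (p ∸ 1) * y + y        ≈⟨ +-congˡ (*-identityˡ y) ⟨
    natCast (p ∸ 1) * y + 1# * y   ≈⟨ distribʳ y _ _ ⟨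
    (natCast (p ∸ 1) + 1#) * y     ≈⟨ *-congʳ natCast[p-1]+1≈0 ⟩
    0# * y                         ≈⟨ zeroˡ y ⟩
    0#                             ∎

  x+[p-1]y+y≈x : ∀ x y → x + natCast (p ∸ 1) * y + y ≈ x
  x+[p-1]y+y≈x x y = trans (+-assoc _ _ _) (trans (+-congˡ ([p-1]y+y≈0 y)) (+-identityʳ x))

  natCast-[p-1]* : ∀ a b → natCast (a ℕ.+ (p ∸ 1) ℕ.* b) + natCast b ≈ natCast a
  natCast-[p-1]* a b = trans (+-congʳ (trans (natCast-homo-+ a _) (+-congˡ (natCast-homo-* (p ∸ 1) b))))
                             (x+[p-1]y+y≈x (natCast a) (natCast b))

  inverse-mod : ∀ {a} → ¬ p ∣ a → ∃ λ b → natCast b * natCast a ≈ 1#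
  inverse-mod {a} p∤a with coprime-Bézout (prime∤⇒coprime p-prime p∤a)
  ... | Bézout.+- x y 1+ya≡xp = (p ∸ 1) ℕ.* y , (begin
    natCast ((p ∸ 1) ℕ.* y) * natCast a      ≈⟨ natCast-homo-* ((p ∸ 1) ℕ.* y) a ⟨
    natCast ((p ∸ 1) ℕ.* y ℕ.* a)            ≡⟨ ≡.cong natCast (ℕₚ.*-assoc (p ∸ 1) y a) ⟩
    natCast ((p ∸ 1) ℕ.* (y ℕ.* a))          ≈⟨ +-cancelʳ (natCast (y ℕ.* a)) _ _ [p-1]ya+ya≈1+ya ⟩
    1#                                       ∎)
    where
    [p-1]ya+ya≈1+ya : natCast ((p ∸ 1) ℕ.* (y ℕ.* a)) + natCast (y ℕ.* a) ≈ 1# + natCast (y ℕ.* a)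
    [p-1]ya+ya≈1+ya = trans (natCast-[p-1]* 0 (y ℕ.* a))
                            (sym (trans (reflexive (≡.cong natCast 1+ya≡xp)) (natCast-*p x)))
  ... | Bézout.-+ x y 1+xp≡ya = y , (begin
    natCast y * natCast a          ≈⟨ natCast-homo-* y a ⟨
    natCast (y ℕ.* a)              ≡⟨ ≡.cong natCast 1+xp≡ya ⟨
    natCast (1 ℕ.+ x ℕ.* p)        ≈⟨ natCast-homo-+ 1 (x ℕ.* p) ⟩
    natCast 1 + natCast (x ℕ.* p)  ≈⟨ +-cong (+-identityʳ 1#) (natCast-*p x) ⟩
    1# + 0#                        ≈⟨ +-identityʳ 1# ⟩
    1#                             ∎)

  natCast≈0⇒p∣ : ∀ {a} → natCast a ≈ 0# → p ∣ a
  natCast≈0⇒p∣ {a} a≈0 with p ∣? a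
  ... | yes p∣a = p∣a
  ... | no  p∤a with inverse-mod p∤a
  ... | b , ba≈1 = ⊥-elim (0≉1 (begin
    0#                    ≈⟨ zeroʳ _ ⟨
    natCast b * 0#        ≈⟨ *-congˡ a≈0 ⟨
    natCast b * natCast a ≈⟨ ba≈1 ⟩
    1#                    ∎))

  natCast≈⇒p∣∸ : ∀ {a b} → a ≤ b → natCast a ≈ natCast b → p ∣ b ∸ a
  natCast≈⇒p∣∸ {a} {b} a≤b a≈b = natCast≈0⇒p∣ (+-identityʳ-unique (natCast a) _ (begin
    natCast a + natCast (b ∸ a)   ≈⟨ natCast-homo-+ a (b ∸ a) ⟨
    natCast (a ℕ.+ (b ∸ a))       ≡⟨ ≡.cong natCast (ℕₚ.m+[n∸m]≡n a≤b) ⟩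
    natCast b                     ≈⟨ a≈b ⟨
    natCast a                     ∎))

  natCast≈⇒≡[mod] : ∀ {a b} → natCast a ≈ natCast b → a ≡ b [mod p ]
  natCast≈⇒≡[mod] {a} {b} a≈b with ℕₚ.≤-total a b
  ... | inj₁ a≤b = ≡.subst (p ∣_) (≡.sym (ℕₚ.m≤n⇒∣m-n∣≡n∸m a≤b)) (natCast≈⇒p∣∸ a≤b a≈b)
  ... | inj₂ b≤a = ≡.subst (p ∣_) (≡.sym (ℕₚ.m≤n⇒∣n-m∣≡n∸m b≤a)) (natCast≈⇒p∣∸ b≤a (sym a≈b))

  natCast≈⇒%≡ : ∀ {a b} → natCast a ≈ natCast b → a % p ≡ b % p
  natCast≈⇒%≡ {a} {b} a≈b with ℕₚ.≤-total a b
  ... | inj₁ a≤b = ≡.sym (≡.trans (≡.cong (_% p) (≡.sym (ℕₚ.m+[n∸m]≡n a≤b)))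
                                  (%-remove-+ʳ a (natCast≈⇒p∣∸ a≤b a≈b)))
  ... | inj₂ b≤a = ≡.trans (≡.cong (_% p) (≡.sym (ℕₚ.m+[n∸m]≡n b≤a)))
                           (%-remove-+ʳ b (natCast≈⇒p∣∸ b≤a (sym a≈b)))

module PolynomialsModP {c ℓ} (K : Field c ℓ) {p} (p-prime : Prime p)
                       (char-p : Field._≈_ K (FieldOps.natCast K p) (Field.0# K)) where
  open Characteristic K p-prime char-p public
  open CoefficientLists public
  open import Relation.Binary.Reasoning.Setoid setoid

  -- A polynomial over 𝔽_p is a list of ℕ-coefficients read in K through natCast,
  -- the prime field of K being 𝔽_p.
  evalℕ : List ℕ → Carrier → Carrier
  evalℕ f = eval (map natCast f)

  DegreeBelow : ℕ → List ℕ → Set ℓ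
  DegreeBelow e f = ∀ k → e ≤ k → natCast (coeff f k) ≈ 0#

  evalℕ-⊕ : ∀ f g x → evalℕ (f ⊕ g) x ≈ evalℕ f x + evalℕ g x
  evalℕ-⊕ []      g       x = sym (+-identityˡ _)
  evalℕ-⊕ (a ∷ f) []      x = sym (+-identityʳ _)
  evalℕ-⊕ (a ∷ f) (b ∷ g) x = begin
    natCast (a ℕ.+ b) + x * evalℕ (f ⊕ g) x
      ≈⟨ +-cong (natCast-homo-+ a b) (*-congˡ (evalℕ-⊕ f g x)) ⟩
    (natCast a + natCast b) + x * (evalℕ f x + evalℕ g x)
      ≈⟨ +-congˡ (distribˡ x _ _) ⟩
    (natCast a + natCast b) + (x * evalℕ f x + x * evalℕ g x)
      ≈⟨ interchange _ _ _ _ ⟩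
    (natCast a + x * evalℕ f x) + (natCast b + x * evalℕ g x)
      ∎
    where open import Algebra.Properties.CommutativeSemigroup +-commutativeSemigroup using (interchange)

  evalℕ-scale : ∀ a g x → evalℕ (scale a g) x ≈ natCast a * evalℕ g x
  evalℕ-scale a []      x = sym (zeroʳ _)
  evalℕ-scale a (b ∷ g) x = begin
    natCast (a ℕ.* b) + x * evalℕ (scale a g) x         ≈⟨ +-cong (natCast-homo-* a b) (*-congˡ (evalℕ-scale a g x)) ⟩
    natCast a * natCast b + x * (natCast a * evalℕ g x) ≈⟨ +-congˡ (x∙yz≈y∙xz x _ _) ⟩
    natCast a * natCast b + natCast a * (x * evalℕ g x) ≈⟨ distribˡ _ _ _ ⟨
    natCast a * (natCast b + x * evalℕ g x)             ∎
    where open import Algebra.Properties.CommutativeSemigroup *-commutativeSemigroup using (x∙yz≈y∙xz)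

  evalℕ-shift : ∀ s g x → evalℕ (shift s g) x ≈ x ^ s * evalℕ g x
  evalℕ-shift zero    g x = sym (*-identityˡ _)
  evalℕ-shift (suc s) g x = begin
    0# + x * evalℕ (shift s g) x  ≈⟨ +-identityˡ _ ⟩
    x * evalℕ (shift s g) x       ≈⟨ *-congˡ (evalℕ-shift s g x) ⟩
    x * (x ^ s * evalℕ g x)       ≈⟨ *-assoc _ _ _ ⟨
    x ^ suc s * evalℕ g x         ∎

  evalℕ-applyUpTo : ∀ F n x → evalℕ (applyUpTo F n) x ≈ ∑[ k < n ] (natCast (F k) * x ^ k)
  evalℕ-applyUpTo F zero    x = refl
  evalℕ-applyUpTo F (suc n) x = begin
    natCast (F 0) + x * evalℕ (applyUpTo (F ∘ suc) n) x
      ≈⟨ +-cong (sym (*-identityʳ _)) (*-congˡ (evalℕ-applyUpTo (F ∘ suc) n x)) ⟩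
    natCast (F 0) * 1# + x * ∑[ k < n ] (natCast (F (suc k)) * x ^ k)
      ≈⟨ +-congˡ (*-distribˡ-∑ n x _) ⟩
    natCast (F 0) * 1# + ∑[ k < n ] (x * (natCast (F (suc k)) * x ^ k))
      ≈⟨ +-congˡ (∑-cong n (λ k _ → x∙yz≈y∙xz x _ _)) ⟩
    natCast (F 0) * 1# + ∑[ k < n ] (natCast (F (suc k)) * x ^ suc k)
      ≈⟨ ∑-suc n (λ k → natCast (F k) * x ^ k) ⟨
    ∑[ k < suc n ] (natCast (F k) * x ^ k)
      ∎
    where open import Algebra.Properties.CommutativeSemigroup *-commutativeSemigroup using (x∙yz≈y∙xz)

  evalℕ-vanishing : ∀ f x → DegreeBelow 0 f → evalℕ f x ≈ 0#
  evalℕ-vanishing []      x _  = refl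
  evalℕ-vanishing (a ∷ f) x f≈0 = begin
    natCast a + x * evalℕ f x ≈⟨ +-cong (f≈0 0 z≤n) (*-congˡ (evalℕ-vanishing f x λ k _ → f≈0 (suc k) z≤n)) ⟩
    0# + x * 0#               ≈⟨ +-identityˡ _ ⟩
    x * 0#                    ≈⟨ zeroʳ x ⟩
    0#                        ∎

  evalℕ-constant : ∀ f x → DegreeBelow 1 f → evalℕ f x ≈ natCast (coeff f 0)
  evalℕ-constant []      x _   = refl
  evalℕ-constant (a ∷ f) x f≈a = begin
    natCast a + x * evalℕ f x ≈⟨ +-congˡ (*-congˡ (evalℕ-vanishing f x (λ k _ → f≈a (suc k) (s≤s z≤n)))) ⟩
    natCast a + x * 0#        ≈⟨ +-congˡ (zeroʳ x) ⟩
    natCast a + 0#            ≈⟨ +-identityʳ _ ⟩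
    natCast a                 ∎

  -- p ∸ 1 acts as −1, so f ⊖ g represents f − g.
  infixl 6 _⊖_
  _⊖_ : List ℕ → List ℕ → List ℕ
  f ⊖ g = f ⊕ scale (p ∸ 1) g

  coeff-⊖ : ∀ f g k → natCast (coeff (f ⊖ g) k) + natCast (coeff g k) ≈ natCast (coeff f k)
  coeff-⊖ f g k = begin
    natCast (coeff (f ⊖ g) k) + natCast (coeff g k)
      ≡⟨ ≡.cong (λ n → natCast n + natCast (coeff g k))
                (≡.trans (coeff-⊕ f _ k) (≡.cong (coeff f k ℕ.+_) (coeff-scale (p ∸ 1) g k))) ⟩
    natCast (coeff f k ℕ.+ (p ∸ 1) ℕ.* coeff g k) + natCast (coeff g k)
      ≈⟨ natCast-[p-1]* (coeff f k) (coeff g k) ⟩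
    natCast (coeff f k)
      ∎

  evalℕ-⊖ : ∀ f g x → evalℕ (f ⊖ g) x + evalℕ g x ≈ evalℕ f x
  evalℕ-⊖ f g x = trans (+-congʳ (trans (evalℕ-⊕ f _ x) (+-congˡ (evalℕ-scale (p ∸ 1) g x))))
                        (x+[p-1]y+y≈x (evalℕ f x) (evalℕ g x))

  evalℕ-expand : ∀ e n x → evalℕ (expand (suc e) (replicate (suc n) 1)) x ≈ geo (x ^ suc e) (suc n)
  evalℕ-expand e zero    x = begin
    natCast 1 + x * 0#  ≈⟨ +-cong (+-identityʳ 1#) (zeroʳ x) ⟩
    1# + 0#             ≈⟨ +-comm 1# 0# ⟩
    0# + 1#             ∎
  evalℕ-expand e (suc n) x = begin
    natCast 1 + x * evalℕ (shift e E) x                 ≈⟨ +-cong (+-identityʳ 1#) (*-congˡ (evalℕ-shift e E x)) ⟩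
    1# + x * (x ^ e * evalℕ E x)                        ≈⟨ +-congˡ (*-assoc x _ _) ⟨
    1# + x ^ suc e * evalℕ E x                          ≈⟨ +-congˡ (*-congˡ (evalℕ-expand e n x)) ⟩
    1# + x ^ suc e * geo (x ^ suc e) (suc n)            ≈⟨ +-comm _ _ ⟩
    x ^ suc e * geo (x ^ suc e) (suc n) + 1#            ≈⟨ geo-shift (x ^ suc e) (suc n) ⟩
    geo (x ^ suc e) (suc (suc n))                       ∎
    where E = expand (suc e) (replicate (suc n) 1)

  module DivisionBy (g : List ℕ) (e g⁻¹ : ℕ) (g⁻¹-inverse : natCast g⁻¹ * natCast (coeff g e) ≈ 1#)
                  (g-degree : DegreeBelow (suc e) g) where

    record Division (f : List ℕ) : Set (c ⊔ ℓ) where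
      field
        quotient remainder : List ℕ
        remainder-degree   : DegreeBelow e remainder
        f≈quotient*g+remainder :
          ∀ k → natCast (coeff f k) ≈ natCast (mulCoeff quotient g k) + natCast (coeff remainder k)
        remainder-root     : ∀ x → evalℕ g x ≈ 0# → evalℕ remainder x ≈ evalℕ f x

    -- One step of long division: t·Xˢ·g cancels the coefficient of X^(s+e) in f.
    module Reduction (s : ℕ) (f : List ℕ) where
      t : ℕ
      t = coeff f (s ℕ.+ e) ℕ.* g⁻¹

      f′ : List ℕ
      f′ = f ⊖ scale t (shift s g)

      coeff-f′ : ∀ k → natCast (coeff f′ k) + natCast (t ℕ.* coeff (shift s g) k) ≈ natCast (coeff f k)
      coeff-f′ k = trans (+-congˡ (reflexive (≡.cong natCast (≡.sym (coeff-scale t (shift s g) k)))))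
                         (coeff-⊖ f (scale t (shift s g)) k)

      degree-f′ : DegreeBelow (suc (s ℕ.+ e)) f → DegreeBelow (s ℕ.+ e) f′
      degree-f′ f-degree k s+e≤k with ℕₚ.m≤n⇒m<n∨m≡n s+e≤k
      ... | inj₂ ≡.refl = +-identityˡ-unique _ _ (trans (coeff-f′ (s ℕ.+ e)) top-cancels)
        where
        top-cancels : natCast (coeff f (s ℕ.+ e)) ≈ natCast (t ℕ.* coeff (shift s g) (s ℕ.+ e))
        top-cancels = begin
          natCast (coeff f (s ℕ.+ e))
            ≈⟨ *-identityʳ _ ⟨
          natCast (coeff f (s ℕ.+ e)) * 1#
            ≈⟨ *-congˡ g⁻¹-inverse ⟨
          natCast (coeff f (s ℕ.+ e)) * (natCast g⁻¹ * natCast (coeff g e))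
            ≈⟨ *-assoc _ _ _ ⟨
          natCast (coeff f (s ℕ.+ e)) * natCast g⁻¹ * natCast (coeff g e)
            ≈⟨ *-congʳ (natCast-homo-* (coeff f (s ℕ.+ e)) g⁻¹) ⟨
          natCast t * natCast (coeff g e)
            ≈⟨ natCast-homo-* t (coeff g e) ⟨
          natCast (t ℕ.* coeff g e)
            ≡⟨ ≡.cong (λ n → natCast (t ℕ.* n)) (coeff-shift-+ s g e) ⟨
          natCast (t ℕ.* coeff (shift s g) (s ℕ.+ e))
            ∎
      ... | inj₁ s+e<k = begin
        natCast (coeff f′ k)                                         ≈⟨ +-identityʳ _ ⟨
        natCast (coeff f′ k) + 0#                                    ≈⟨ +-congˡ tXˢg≈0 ⟨
        natCast (coeff f′ k) + natCast (t ℕ.* coeff (shift s g) k)   ≈⟨ coeff-f′ k ⟩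
        natCast (coeff f k)                                          ≈⟨ f-degree k s+e<k ⟩
        0#                                                           ∎
        where
        s≤k : s ≤ k
        s≤k = ℕₚ.≤-trans (ℕₚ.m≤m+n s e) (ℕₚ.<⇒≤ s+e<k)
        tXˢg≈0 : natCast (t ℕ.* coeff (shift s g) k) ≈ 0#
        tXˢg≈0 = begin
          natCast (t ℕ.* coeff (shift s g) k)     ≈⟨ natCast-homo-* t _ ⟩
          natCast t * natCast (coeff (shift s g) k) ≡⟨ ≡.cong (λ n → natCast t * natCast n) (coeff-shift-≥ s g s≤k) ⟩
          natCast t * natCast (coeff g (k ∸ s))   ≈⟨ *-congˡ (g-degree (k ∸ s) (ℕₚ.+-cancelˡ-≤ s _ _ e<k∸s)) ⟩
          natCast t * 0#                          ≈⟨ zeroʳ _ ⟩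
          0#                                      ∎
          where
          e<k∸s : s ℕ.+ suc e ≤ s ℕ.+ (k ∸ s)
          e<k∸s = ≡.subst₂ _≤_ (≡.sym (ℕₚ.+-suc s e)) (≡.sym (ℕₚ.m+[n∸m]≡n s≤k)) s+e<k

      root-f′ : ∀ x → evalℕ g x ≈ 0# → evalℕ f′ x ≈ evalℕ f x
      root-f′ x gx≈0 = begin
        evalℕ f′ x                                   ≈⟨ +-identityʳ _ ⟨
        evalℕ f′ x + 0#                              ≈⟨ +-congˡ tXˢg≈0 ⟨
        evalℕ f′ x + evalℕ (scale t (shift s g)) x   ≈⟨ evalℕ-⊖ f _ x ⟩
        evalℕ f x                                    ∎
        where
        tXˢg≈0 : evalℕ (scale t (shift s g)) x ≈ 0#
        tXˢg≈0 = begin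
          evalℕ (scale t (shift s g)) x   ≈⟨ evalℕ-scale t (shift s g) x ⟩
          natCast t * evalℕ (shift s g) x ≈⟨ *-congˡ (evalℕ-shift s g x) ⟩
          natCast t * (x ^ s * evalℕ g x) ≈⟨ *-congˡ (*-congˡ gx≈0) ⟩
          natCast t * (x ^ s * 0#)        ≈⟨ *-congˡ (zeroʳ _) ⟩
          natCast t * 0#                  ≈⟨ zeroʳ _ ⟩
          0#                              ∎

    divide : ∀ s f → DegreeBelow (s ℕ.+ e) f → Division f
    divide zero    f f-degree = record
      { quotient = [] ; remainder = f ; remainder-degree = f-degree
      ; f≈quotient*g+remainder = λ k → sym (trans (+-congʳ (reflexive (≡.cong natCast (mulCoeff-[] g k))))
                                                    (+-identityˡ _))
      ; remainder-root = λ _ _ → refl }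
    divide (suc s) f f-degree = record
      { quotient = quotient ⊕ monomial s t ; remainder = remainder ; remainder-degree = remainder-degree
      ; f≈quotient*g+remainder = f≈Q*g+r
      ; remainder-root = λ x gx≈0 → trans (remainder-root x gx≈0) (root-f′ x gx≈0) }
      where
      open Reduction s f
      open Division (divide s f′ (degree-f′ f-degree))
      open import Algebra.Properties.CommutativeSemigroup +-commutativeSemigroup using (xy∙z≈xz∙y)
      f≈Q*g+r : ∀ k → natCast (coeff f k) ≈
                      natCast (mulCoeff (quotient ⊕ monomial s t) g k) + natCast (coeff remainder k)
      f≈Q*g+r k = begin
        natCast (coeff f k)
          ≈⟨ coeff-f′ k ⟨
        natCast (coeff f′ k) + natCast (t ℕ.* coeff (shift s g) k)
          ≈⟨ +-congʳ (f≈quotient*g+remainder k) ⟩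
        natCast (mulCoeff quotient g k) + natCast (coeff remainder k) + natCast (t ℕ.* coeff (shift s g) k)
          ≈⟨ xy∙z≈xz∙y _ _ _ ⟩
        natCast (mulCoeff quotient g k) + natCast (t ℕ.* coeff (shift s g) k) + natCast (coeff remainder k)
          ≈⟨ +-congʳ (natCast-homo-+ (mulCoeff quotient g k) _) ⟨
        natCast (mulCoeff quotient g k ℕ.+ t ℕ.* coeff (shift s g) k) + natCast (coeff remainder k)
          ≡⟨ ≡.cong (λ n → natCast n + natCast (coeff remainder k)) mulCoeff-Q ⟨
        natCast (mulCoeff (quotient ⊕ monomial s t) g k) + natCast (coeff remainder k)
          ∎
        where
        mulCoeff-Q : mulCoeff (quotient ⊕ monomial s t) g k ≡ mulCoeff quotient g k ℕ.+ t ℕ.* coeff (shift s g) k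
        mulCoeff-Q = ≡.trans (mulCoeff-⊕ quotient _ g k)
                             (≡.cong (mulCoeff quotient g k ℕ.+_) (mulCoeff-monomial s t g k))

  DegreeBelow-pred : ∀ {e} f → DegreeBelow (suc e) f → p ∣ coeff f e → DegreeBelow e f
  DegreeBelow-pred f f-degree p∣top k e≤k with ℕₚ.m≤n⇒m<n∨m≡n e≤k
  ... | inj₁ e<k    = f-degree k e<k
  ... | inj₂ ≡.refl = p∣⇒natCast≈0 p∣top

  ¬PosDegMod⇒DegreeBelow1 : ∀ q → ¬ PosDegMod p q → DegreeBelow 1 q
  ¬PosDegMod⇒DegreeBelow1 q q-constant k 1≤k with p ∣? coeff q k
  ... | yes p∣qₖ = p∣⇒natCast≈0 p∣qₖ
  ... | no  p∤qₖ = ⊥-elim (q-constant (k , 1≤k , p∤qₖ))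

  mulCoeff-constant : ∀ q f {e} → DegreeBelow 1 q → DegreeBelow e f →
                      ∀ k → e ≤ k → natCast (mulCoeff q f k) ≈ 0#
  mulCoeff-constant q f q-degree f-degree k e≤k = begin
    natCast (mulCoeff q f k)                                        ≡⟨ ≡.cong natCast (mulCoeff-∑ q f k) ⟩
    natCast (ℕ∑.∑< (suc k) (λ i → coeff q i ℕ.* coeff f (k ∸ i)))   ≈⟨ natCast-∑ (suc k) _ ⟩
    ∑[ i < suc k ] natCast (coeff q i ℕ.* coeff f (k ∸ i))          ≈⟨ ∑-zero (suc k) term≈0 ⟩
    0#                                                              ∎
    where
    term≈0 : ∀ i → i < suc k → natCast (coeff q i ℕ.* coeff f (k ∸ i)) ≈ 0#
    term≈0 zero    _ = trans (natCast-homo-* (coeff q 0) (coeff f k))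
                             (trans (*-congˡ (f-degree k e≤k)) (zeroʳ _))
    term≈0 (suc i) _ = trans (natCast-homo-* (coeff q (suc i)) (coeff f (k ∸ suc i)))
                             (trans (*-congʳ (q-degree (suc i) (s≤s z≤n))) (zeroˡ _))

  module MinimalPolynomial (Φ : List ℕ) (D : ℕ) (Φ-monic : coeff Φ D ≡ 1) (Φ-degree : DegreeBelow (suc D) Φ)
                           (Φ-irreducible : IrreducibleMod p Φ) (ζ : Carrier) (Φζ≈0 : evalℕ Φ ζ ≈ 0#) where

    -- Were the top coefficient of f a unit, dividing Φ by f would leave a remainder of lower
    -- degree vanishing at ζ, hence zero; then Φ ≡ Q·f contradicts irreducibility if Q is not
    -- constant, and the degree of Φ if it is.
    degree-drops : ∀ e → suc e < D → (∀ r → DegreeBelow (suc e) r → evalℕ r ζ ≈ 0# → DegreeBelow 0 r) →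
                   ∀ f → DegreeBelow (suc (suc e)) f → evalℕ f ζ ≈ 0# → DegreeBelow (suc e) f
    degree-drops e e<D lower-roots-vanish f f-degree fζ≈0 with p ∣? coeff f (suc e)
    ... | yes p∣top = DegreeBelow-pred f f-degree p∣top
    ... | no  p∤top = ⊥-elim (0≉1 (begin
      0#                                 ≈⟨ mulCoeff-constant quotient f Q-constant f-degree D e<D ⟨
      natCast (mulCoeff quotient f D)    ≈⟨ Φ≈Q*f D ⟨
      natCast (coeff Φ D)                ≡⟨ ≡.cong natCast Φ-monic ⟩
      1# + 0#                            ≈⟨ +-identityʳ 1# ⟩
      1#                                 ∎))
      where
      open DivisionBy f (suc e) (proj₁ (inverse-mod p∤top)) (proj₂ (inverse-mod p∤top)) f-degree
      Φ-degree′ : DegreeBelow ((D ∸ e) ℕ.+ suc e) Φ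
      Φ-degree′ = ≡.subst (λ n → DegreeBelow n Φ)
                          (≡.sym (≡.trans (ℕₚ.+-suc (D ∸ e) e) (≡.cong suc (ℕₚ.m∸n+n≡m e≤D)))) Φ-degree
        where e≤D = ℕₚ.≤-trans (ℕₚ.n≤1+n e) (ℕₚ.<⇒≤ e<D)
      open Division (divide (D ∸ e) Φ Φ-degree′)
      Φ≈Q*f : ∀ k → natCast (coeff Φ k) ≈ natCast (mulCoeff quotient f k)
      Φ≈Q*f k = begin
        natCast (coeff Φ k)                                              ≈⟨ f≈quotient*g+remainder k ⟩
        natCast (mulCoeff quotient f k) + natCast (coeff remainder k)    ≈⟨ +-congˡ (remainder≈0 k z≤n) ⟩
        natCast (mulCoeff quotient f k) + 0#                             ≈⟨ +-identityʳ _ ⟩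
        natCast (mulCoeff quotient f k)                                  ∎
        where
        remainder≈0 : DegreeBelow 0 remainder
        remainder≈0 = lower-roots-vanish remainder remainder-degree (trans (remainder-root ζ fζ≈0) Φζ≈0)
      Q-constant : DegreeBelow 1 quotient
      Q-constant = ¬PosDegMod⇒DegreeBelow1 quotient λ Q-positive → proj₂ Φ-irreducible
        (quotient , f , Q-positive , (suc e , s≤s z≤n , p∤top) ,
         λ k → natCast≈⇒≡[mod] {mulCoeff quotient f k} (sym (Φ≈Q*f k)))

    constant-root⇒zero : ∀ f → DegreeBelow 1 f → evalℕ f ζ ≈ 0# → DegreeBelow 0 f
    constant-root⇒zero f f-degree fζ≈0 zero    _ = trans (sym (evalℕ-constant f ζ f-degree)) fζ≈0
    constant-root⇒zero f f-degree fζ≈0 (suc k) _ = f-degree (suc k) (s≤s z≤n)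

    lowerDegree-root⇒zero : ∀ e → e ≤ D → ∀ f → DegreeBelow e f → evalℕ f ζ ≈ 0# → DegreeBelow 0 f
    lowerDegree-root⇒zero zero          _   f f-degree _    = f-degree
    lowerDegree-root⇒zero (suc zero)    _   f f-degree fζ≈0 = constant-root⇒zero f f-degree fζ≈0
    lowerDegree-root⇒zero (suc (suc e)) e<D f f-degree fζ≈0 =
      lowerDegree-root⇒zero (suc e) (ℕₚ.<⇒≤ e<D) f
        (degree-drops e e<D (lowerDegree-root⇒zero (suc e) (ℕₚ.<⇒≤ e<D)) f f-degree fζ≈0) fζ≈0

    powers-independent : ∀ F → ∑[ k < D ] (natCast (F k) * ζ ^ k) ≈ 0# → ∀ k → k < D → natCast (F k) ≈ 0#
    powers-independent F ∑≈0 k k<D = begin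
      natCast (F k)                   ≡⟨ ≡.cong natCast (coeff-applyUpTo-< F D k<D) ⟨
      natCast (coeff (applyUpTo F D) k) ≈⟨ lowerDegree-root⇒zero D ℕₚ.≤-refl (applyUpTo F D) degree root k z≤n ⟩
      0#                              ∎
      where
      degree : DegreeBelow D (applyUpTo F D)
      degree k D≤k = reflexive (≡.cong natCast (coeff-applyUpTo-≥ F D D≤k))
      root : evalℕ (applyUpTo F D) ζ ≈ 0#
      root = trans (evalℕ-applyUpTo F D ζ) ∑≈0

module RootsOfUnity {c ℓ} (K : Field c ℓ) {p} (p-prime : Prime p) (closure : IsAlgebraicClosureOfFp p K)
                    {l} (l-prime : Prime l) (p≢l : p ≢ l) (a′ : ℕ) where
  open IsAlgebraicClosureOfFp closure using (characteristic; algClosed)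
  open PolynomialsModP K p-prime characteristic public
  open import Relation.Binary.Reasoning.Setoid setoid

  -- a = suc a′, so m = l ^ a is l * d definitionally.
  d m : ℕ
  d = l ℕ.^ a′
  m = l ℕ.^ suc a′

  instance
    l≢0 : NonZero l
    l≢0 = prime⇒nonZero l-prime
    d≢0 : NonZero d
    d≢0 = ℕₚ.m^n≢0 l a′
    m≢0 : NonZero m
    m≢0 = ℕₚ.m^n≢0 l (suc a′)

  eval-ones : ∀ n x → eval (replicate n 1# ++ [ 1# ]) x ≈ geo x (suc n)
  eval-ones zero    x = trans (+-congˡ (zeroʳ x)) (trans (+-identityʳ 1#) (sym (+-identityˡ 1#)))
  eval-ones (suc n) x = trans (+-comm _ _) (trans (+-congʳ (*-congˡ (eval-ones n x))) (geo-shift x (suc n)))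

  eval-Xⁿ : ∀ n x → eval (replicate n 0# ++ [ 1# ]) x ≈ x ^ n
  eval-Xⁿ zero    x = trans (+-congˡ (zeroʳ x)) (+-identityʳ 1#)
  eval-Xⁿ (suc n) x = trans (+-identityˡ _) (*-congˡ (eval-Xⁿ n x))

  geo-has-root : ∀ n → 1 < n → ∃ λ η → geo η n ≈ 0#
  geo-has-root (suc zero)    (s≤s ())
  geo-has-root (suc (suc n)) _         with algClosed 1# (replicate n 1#)
  ... | η , root = η , trans (sym (eval-ones (suc n) η)) root

  has-root : ∀ n → .{{NonZero n}} → ∀ y → ∃ λ ζ → ζ ^ n ≈ y
  has-root (suc n) y with algClosed (- y) (replicate n 0#)
  ... | ζ , root = ζ , (begin
    ζ ^ suc n   ≈⟨ *-congˡ (eval-Xⁿ n ζ) ⟨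
    ζ * eval (replicate n 0# ++ [ 1# ]) ζ ≈⟨ +-inverseʳ-unique (- y) _ root ⟩
    - - y       ≈⟨ -‿involutive y ⟩
    y           ∎)

  η : Carrier
  η = proj₁ (geo-has-root l (prime>1 l-prime))

  geo-η : geo η l ≈ 0#
  geo-η = proj₂ (geo-has-root l (prime>1 l-prime))

  ζ : Carrier
  ζ = proj₁ (has-root d η)

  ζ^d≈η : ζ ^ d ≈ η
  ζ^d≈η = proj₂ (has-root d η)

  η^l≈1 : η ^ l ≈ 1#
  η^l≈1 = geo≈0⇒^≈1 l geo-η

  natCast-m≉0 : ¬ natCast m ≈ 0#
  natCast-m≉0 m≈0 = prime∤prime p-prime l-prime p≢l (prime∣^⇒∣ p-prime (suc a′) (natCast≈0⇒p∣ m≈0))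

  η≉1 : ¬ η ≈ 1#
  η≉1 η≈1 = prime∤prime p-prime l-prime p≢l (natCast≈0⇒p∣ (begin
    natCast l   ≈⟨ geo-1 l ⟨
    geo 1# l    ≈⟨ ∑-cong l (λ i _ → ^-congˡ i η≈1) ⟨
    geo η l     ≈⟨ geo-η ⟩
    0#          ∎))

  ζ^m≈1 : ζ ^ m ≈ 1#
  ζ^m≈1 = begin
    ζ ^ (l ℕ.* d)   ≡⟨ ≡.cong (ζ ^_) (ℕₚ.*-comm l d) ⟩
    ζ ^ (d ℕ.* l)   ≈⟨ ^-assocʳ ζ d l ⟨
    (ζ ^ d) ^ l     ≈⟨ ^-congˡ l ζ^d≈η ⟩
    η ^ l           ≈⟨ η^l≈1 ⟩
    1#              ∎

  -- gcd(k, m) is a proper divisor of m = l^(a′+1), hence divides d; and ζ^gcd(k,m) = 1.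
  ζ-primitive : ∀ k → 0 < k → k < m → ¬ ζ ^ k ≈ 1#
  ζ-primitive k 0<k k<m ζᵏ≈1 with Bézout.lemma k m
  ... | Bézout.result g g-gcd g-bézout with divisor-of-prime-power l-prime a′ (proj₂ (GCD.commonDivisor g-gcd))
  ... | inj₂ g≡m =
    ℕₚ.<-irrefl g≡m (ℕₚ.≤-<-trans (∣⇒≤ {{ℕ.>-nonZero 0<k}} (proj₁ (GCD.commonDivisor g-gcd))) k<m)
  ... | inj₁ (divides q d≡qg) = η≉1 (begin
    η               ≈⟨ ζ^d≈η ⟨
    ζ ^ d           ≡⟨ ≡.cong (ζ ^_) d≡qg ⟩
    ζ ^ (q ℕ.* g)   ≈⟨ ^-*≈1 q g (^≈1-bézout ζᵏ≈1 ζ^m≈1 g-bézout) ⟩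
    1#              ∎)

  ζ⁻¹ : Carrier
  ζ⁻¹ = ζ ^ (m ∸ 1)

  ζζ⁻¹≈1 : ζ * ζ⁻¹ ≈ 1#
  ζζ⁻¹≈1 = trans (reflexive (≡.cong (ζ ^_) (ℕₚ.suc-pred m))) ζ^m≈1

  ζ^k*ζ⁻¹^k≈1 : ∀ k → ζ ^ k * ζ⁻¹ ^ k ≈ 1#
  ζ^k*ζ⁻¹^k≈1 k = trans (sym (^-distrib-* ζ ζ⁻¹ k)) (trans (^-congˡ k ζζ⁻¹≈1) (1^n≈1 k))

  ζ⁻¹-primitive : ∀ k → 0 < k → k < m → ¬ ζ⁻¹ ^ k ≈ 1#
  ζ⁻¹-primitive k 0<k k<m ζ⁻ᵏ≈1 = ζ-primitive k 0<k k<m (begin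
    ζ ^ k                ≈⟨ *-identityʳ _ ⟨
    ζ ^ k * 1#           ≈⟨ *-congˡ ζ⁻ᵏ≈1 ⟨
    ζ ^ k * ζ⁻¹ ^ k      ≈⟨ ζ^k*ζ⁻¹^k≈1 k ⟩
    1#                   ∎)

  -- If α were no power of ζ, each geometric sum Σ_k (α ζ^(−j))^k would vanish; summing over
  -- j first instead leaves only the term k = 0, which is m ≠ 0.
  root-of-unity⇒power : ∀ α → α ^ m ≈ 1# → ¬ (∀ j → j < m → ¬ α ≈ ζ ^ j)
  root-of-unity⇒power α α^m≈1 α≉powers = natCast-m≉0 (begin
    natCast m                                         ≈⟨ geo-1 m ⟨
    geo 1# m                                          ≈⟨ *-identityˡ _ ⟨
    α ^ 0 * geo (ζ⁻¹ ^ 0) m                           ≈⟨ ∑-single m 0 (ℕ.>-nonZero⁻¹ m) other-terms ⟨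
    ∑[ k < m ] (α ^ k * geo (ζ⁻¹ ^ k) m)              ≈⟨ ∑-cong m (λ k _ → *-distribˡ-∑ m (α ^ k) _) ⟩
    ∑[ k < m ] ∑[ j < m ] (α ^ k * (ζ⁻¹ ^ k) ^ j)     ≈⟨ ∑-comm m m _ ⟩
    ∑[ j < m ] ∑[ k < m ] (α ^ k * (ζ⁻¹ ^ k) ^ j)     ≈⟨ ∑-cong m (λ j _ → ∑-cong m (λ k _ → reorder j k)) ⟩
    ∑[ j < m ] geo (α * ζ⁻¹ ^ j) m                    ≈⟨ ∑-zero m (λ j j<m → geo-vanish m (β^m≈1 j) (β≉1 j j<m)) ⟩
    0#                                                ∎)
    where
    other-terms : ∀ k → k < m → k ≢ 0 → α ^ k * geo (ζ⁻¹ ^ k) m ≈ 0#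
    other-terms k k<m k≢0 = trans (*-congˡ (geo-vanish m (^-^≈1 k m (^-^≈1 (m ∸ 1) m ζ^m≈1))
                                                        (ζ⁻¹-primitive k (ℕₚ.n≢0⇒n>0 k≢0) k<m)))
                                  (zeroʳ _)
    reorder : ∀ j k → α ^ k * (ζ⁻¹ ^ k) ^ j ≈ (α * ζ⁻¹ ^ j) ^ k
    reorder j k = trans (*-congˡ (^-comm ζ⁻¹ k j)) (sym (^-distrib-* α (ζ⁻¹ ^ j) k))
    β^m≈1 : ∀ j → (α * ζ⁻¹ ^ j) ^ m ≈ 1#
    β^m≈1 j = begin
      (α * ζ⁻¹ ^ j) ^ m        ≈⟨ ^-distrib-* α _ m ⟩
      α ^ m * (ζ⁻¹ ^ j) ^ m    ≈⟨ *-cong α^m≈1 (^-^≈1 j m (^-^≈1 (m ∸ 1) m ζ^m≈1)) ⟩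
      1# * 1#                  ≈⟨ *-identityˡ 1# ⟩
      1#                       ∎
    β≉1 : ∀ j → j < m → ¬ α * ζ⁻¹ ^ j ≈ 1#
    β≉1 j j<m β≈1 = α≉powers j j<m (begin
      α                        ≈⟨ *-identityʳ α ⟨
      α * 1#                   ≈⟨ *-congˡ (ζ^k*ζ⁻¹^k≈1 j) ⟨
      α * (ζ ^ j * ζ⁻¹ ^ j)    ≈⟨ x∙yz≈xz∙y α _ _ ⟩
      (α * ζ⁻¹ ^ j) * ζ ^ j    ≈⟨ *-congʳ β≈1 ⟩
      1# * ζ ^ j               ≈⟨ *-identityˡ _ ⟩
      ζ ^ j                    ∎)
      where open import Algebra.Properties.CommutativeSemigroup *-commutativeSemigroup using (x∙yz≈xz∙y)

module SumsOfRootsOfUnity {c ℓ} (K : Field c ℓ) {p} (p-prime : Prime p) (closure : IsAlgebraicClosureOfFp p K)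
                          {l} (l-prime : Prime l) (p≢l : p ≢ l) (a′ : ℕ)
                          (Φ-irreducible : IrreducibleMod p (cyclotomicPrimePower l (suc a′))) where
  open RootsOfUnity K p-prime closure l-prime p≢l a′ public
  open IsAlgebraicClosureOfFp closure using (characteristic)
  open Multiplicities
  open BlockSums using ([t*d+r]%d≡r; ∑-blockwise-congruent)
  open import Relation.Binary.Reasoning.Setoid setoid

  D : ℕ
  D = (l ∸ 1) ℕ.* d

  m≡D+d : m ≡ D ℕ.+ d
  m≡D+d = ≡.trans (≡.cong (ℕ._* d) (≡.sym (ℕₚ.suc-pred l))) (ℕₚ.+-comm d D)

  Φ : List ℕ
  Φ = cyclotomicPrimePower l (suc a′)

  Φ≡expand : Φ ≡ expand (suc (d ∸ 1)) (replicate (suc (l ∸ 1)) 1)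
  Φ≡expand = ≡.cong₂ (λ e n → expand e (replicate n 1)) (≡.sym (ℕₚ.suc-pred d)) (≡.sym (ℕₚ.suc-pred l))

  top-degree≡D : (l ∸ 1) ℕ.* suc (d ∸ 1) ≡ D
  top-degree≡D = ≡.cong ((l ∸ 1) ℕ.*_) (ℕₚ.suc-pred d)

  Φ-monic : coeff Φ D ≡ 1
  Φ-monic = ≡.subst₂ (λ f k → coeff f k ≡ 1) (≡.sym Φ≡expand) top-degree≡D (coeff-expand-top (d ∸ 1) (l ∸ 1))

  Φ-degree : DegreeBelow (suc D) Φ
  Φ-degree k D<k = reflexive (≡.cong natCast (≡.trans (≡.cong (λ f → coeff f k) Φ≡expand)
                     (coeff-expand-high (d ∸ 1) (l ∸ 1) (≡.subst (_< k) (≡.sym top-degree≡D) D<k))))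

  Φζ≈0 : evalℕ Φ ζ ≈ 0#
  Φζ≈0 = begin
    evalℕ Φ ζ
      ≡⟨ ≡.cong (λ f → evalℕ f ζ) Φ≡expand ⟩
    evalℕ (expand (suc (d ∸ 1)) (replicate (suc (l ∸ 1)) 1)) ζ
      ≈⟨ evalℕ-expand (d ∸ 1) (l ∸ 1) ζ ⟩
    geo (ζ ^ suc (d ∸ 1)) (suc (l ∸ 1))
      ≡⟨ ≡.cong₂ (λ e n → geo (ζ ^ e) n) (ℕₚ.suc-pred d) (ℕₚ.suc-pred l) ⟩
    geo (ζ ^ d) l
      ≈⟨ ∑-cong l (λ i _ → ^-congˡ i ζ^d≈η) ⟩
    geo η l
      ≈⟨ geo-η ⟩
    0#
      ∎

  open MinimalPolynomial Φ D Φ-monic Φ-degree Φ-irreducible ζ Φζ≈0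

  ζ^[td]≈η^t : ∀ t → ζ ^ (t ℕ.* d) ≈ η ^ t
  ζ^[td]≈η^t t = begin
    ζ ^ (t ℕ.* d)   ≡⟨ ≡.cong (ζ ^_) (ℕₚ.*-comm t d) ⟩
    ζ ^ (d ℕ.* t)   ≈⟨ ^-assocʳ ζ d t ⟨
    (ζ ^ d) ^ t     ≈⟨ ^-congˡ t ζ^d≈η ⟩
    η ^ t           ∎

  -- The value at ζ of (Σ_{r<d} w_r X^r) · Φ(X).
  periodic-sum-vanishes : ∀ (w : ℕ → Carrier) → ∑[ k < m ] (w (k % d) * ζ ^ k) ≈ 0#
  periodic-sum-vanishes w = begin
    ∑[ k < m ] (w (k % d) * ζ ^ k)
      ≈⟨ ∑-* l d _ ⟩
    ∑[ t < l ] ∑[ r < d ] (w ((t ℕ.* d ℕ.+ r) % d) * ζ ^ (t ℕ.* d ℕ.+ r))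
      ≈⟨ ∑-cong l (λ t _ → ∑-cong d (λ r r<d → term t r r<d)) ⟩
    ∑[ t < l ] ∑[ r < d ] (w r * ζ ^ r * η ^ t)
      ≈⟨ ∑-comm l d _ ⟩
    ∑[ r < d ] ∑[ t < l ] (w r * ζ ^ r * η ^ t)
      ≈⟨ ∑-cong d (λ r _ → *-distribˡ-∑ l (w r * ζ ^ r) (η ^_)) ⟨
    ∑[ r < d ] (w r * ζ ^ r * geo η l)
      ≈⟨ ∑-zero d (λ r _ → trans (*-congˡ geo-η) (zeroʳ _)) ⟩
    0#
      ∎
    where
    term : ∀ t r → r < d → w ((t ℕ.* d ℕ.+ r) % d) * ζ ^ (t ℕ.* d ℕ.+ r) ≈ w r * ζ ^ r * η ^ t
    term t r r<d = begin
      w ((t ℕ.* d ℕ.+ r) % d) * ζ ^ (t ℕ.* d ℕ.+ r)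
        ≡⟨ ≡.cong (λ i → w i * ζ ^ (t ℕ.* d ℕ.+ r)) ([t*d+r]%d≡r t r<d) ⟩
      w r * ζ ^ (t ℕ.* d ℕ.+ r)
        ≈⟨ *-congˡ (^-homo-* ζ (t ℕ.* d) r) ⟩
      w r * (ζ ^ (t ℕ.* d) * ζ ^ r)
        ≈⟨ *-congˡ (*-congʳ (ζ^[td]≈η^t t)) ⟩
      w r * (η ^ t * ζ ^ r)
        ≈⟨ *-congˡ (*-comm _ _) ⟩
      w r * (ζ ^ r * η ^ t)
        ≈⟨ *-assoc _ _ _ ⟨
      w r * ζ ^ r * η ^ t
        ∎

  sumPowers : List ℕ → Carrier
  sumPowers []       = 0#
  sumPowers (j ∷ js) = ζ ^ j + sumPowers js

  ∑-multiplicity : ∀ js → All (_< m) js → ∑[ k < m ] (natCast (multiplicity js k) * ζ ^ k) ≈ sumPowers js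
  ∑-multiplicity []       []           = ∑-zero m (λ k _ → zeroˡ _)
  ∑-multiplicity (j ∷ js) (j<m ∷ js<m) = begin
    ∑[ k < m ] (natCast (δ k j ℕ.+ multiplicity js k) * ζ ^ k)
      ≈⟨ ∑-cong m (λ k _ → natCast-+-distribʳ (δ k j) _ _) ⟩
    ∑[ k < m ] (natCast (δ k j) * ζ ^ k + natCast (multiplicity js k) * ζ ^ k)
      ≈⟨ ∑-distrib-+ m _ _ ⟩
    ∑[ k < m ] (natCast (δ k j) * ζ ^ k) + ∑[ k < m ] (natCast (multiplicity js k) * ζ ^ k)
      ≈⟨ +-cong ∑δ≈ζ^j (∑-multiplicity js js<m) ⟩
    ζ ^ j + sumPowers js
      ∎
    where
    ∑δ≈ζ^j : ∑[ k < m ] (natCast (δ k j) * ζ ^ k) ≈ ζ ^ j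
    ∑δ≈ζ^j = begin
      ∑[ k < m ] (natCast (δ k j) * ζ ^ k)
        ≈⟨ ∑-single m j j<m (λ k _ k≢j → trans (*-congʳ (reflexive (≡.cong natCast (δ-≢ k≢j)))) (zeroˡ _)) ⟩
      natCast (δ j j) * ζ ^ j
        ≡⟨ ≡.cong (λ n → natCast n * ζ ^ j) (δ-refl j) ⟩
      (1# + 0#) * ζ ^ j
        ≈⟨ *-congʳ (+-identityʳ 1#) ⟩
      1# * ζ ^ j
        ≈⟨ *-identityˡ _ ⟩
      ζ ^ j
        ∎

  -- The coefficients of Σ_{j ∈ js} X^j reduced below degree D by X^(D+r) ≡ −Σ_{t<l−1} X^(td+r).
  reduced : List ℕ → ℕ → ℕ
  reduced js k = multiplicity js k ℕ.+ (p ∸ 1) ℕ.* multiplicity js (D ℕ.+ k % d)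

  reduced-block : ∀ js t r → r < d → reduced js (t ℕ.* d ℕ.+ r) ≡
                  multiplicity js (t ℕ.* d ℕ.+ r) ℕ.+ (p ∸ 1) ℕ.* multiplicity js (D ℕ.+ r)
  reduced-block js t r r<d = ≡.cong (λ i → multiplicity js k ℕ.+ (p ∸ 1) ℕ.* multiplicity js (D ℕ.+ i))
                                    ([t*d+r]%d≡r t r<d)
    where k = t ℕ.* d ℕ.+ r

  reduced-top≈0 : ∀ js r → r < d → natCast (reduced js (D ℕ.+ r)) ≈ 0#
  reduced-top≈0 js r r<d = +-identityˡ-unique _ (natCast a) (begin
    natCast (reduced js (D ℕ.+ r)) + natCast a
      ≡⟨ ≡.cong (λ n → natCast n + natCast a) (reduced-block js (l ∸ 1) r r<d) ⟩
    natCast (a ℕ.+ (p ∸ 1) ℕ.* a) + natCast a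
      ≈⟨ natCast-[p-1]* a a ⟩
    natCast a
      ∎)
    where a = multiplicity js (D ℕ.+ r)

  ∑-reduced : ∀ js → All (_< m) js → ∑[ k < D ] (natCast (reduced js k) * ζ ^ k) ≈ sumPowers js
  ∑-reduced js js<m = begin
    ∑[ k < D ] (R k)
      ≈⟨ +-identityʳ _ ⟨
    ∑[ k < D ] (R k) + 0#
      ≈⟨ +-congˡ (∑-zero d top≈0) ⟨
    ∑[ k < D ] (R k) + ∑[ r < d ] (R (D ℕ.+ r))
      ≈⟨ ∑-+ D d R ⟨
    ∑[ k < D ℕ.+ d ] (R k)
      ≡⟨ ≡.cong (λ n → ∑< n R) m≡D+d ⟨
    ∑[ k < m ] (R k)
      ≈⟨ ∑-cong m (λ k _ → split k) ⟩
    ∑[ k < m ] (N k + natCast (p ∸ 1) * M k)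
      ≈⟨ ∑-distrib-+ m N _ ⟩
    ∑[ k < m ] (N k) + ∑[ k < m ] (natCast (p ∸ 1) * M k)
      ≈⟨ +-congˡ (*-distribˡ-∑ m (natCast (p ∸ 1)) M) ⟨
    ∑[ k < m ] (N k) + natCast (p ∸ 1) * ∑[ k < m ] (M k)
      ≈⟨ +-congˡ (*-congˡ (periodic-sum-vanishes w)) ⟩
    ∑[ k < m ] (N k) + natCast (p ∸ 1) * 0#
      ≈⟨ +-congˡ (zeroʳ _) ⟩
    ∑[ k < m ] (N k) + 0#
      ≈⟨ +-identityʳ _ ⟩
    ∑[ k < m ] (N k)
      ≈⟨ ∑-multiplicity js js<m ⟩
    sumPowers js
      ∎
    where
    w : ℕ → Carrier
    w r = natCast (multiplicity js (D ℕ.+ r))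
    R N M : ℕ → Carrier
    R k = natCast (reduced js k) * ζ ^ k
    N k = natCast (multiplicity js k) * ζ ^ k
    M k = w (k % d) * ζ ^ k
    top≈0 : ∀ r → r < d → R (D ℕ.+ r) ≈ 0#
    top≈0 r r<d = trans (*-congʳ (reduced-top≈0 js r r<d)) (zeroˡ _)
    split : ∀ k → R k ≈ N k + natCast (p ∸ 1) * M k
    split k = begin
      R k
        ≈⟨ natCast-+-distribʳ (multiplicity js k) _ _ ⟩
      N k + natCast ((p ∸ 1) ℕ.* multiplicity js (D ℕ.+ k % d)) * ζ ^ k
        ≈⟨ +-congˡ (*-congʳ (natCast-homo-* (p ∸ 1) _)) ⟩
      N k + natCast (p ∸ 1) * w (k % d) * ζ ^ k
        ≈⟨ +-congˡ (*-assoc _ _ _) ⟩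
      N k + natCast (p ∸ 1) * M k
        ∎

  multiplicity-periodic : ∀ js → All (_< m) js → sumPowers js ≈ 0# → ∀ t r → t < l → r < d →
                          multiplicity js (t ℕ.* d ℕ.+ r) % p ≡ multiplicity js (D ℕ.+ r) % p
  multiplicity-periodic js js<m ∑≈0 t r t<l r<d with ℕₚ.m≤n⇒m<n∨m≡n (ℕₚ.<⇒≤pred t<l)
  ... | inj₂ ≡.refl = ≡.refl
  ... | inj₁ t<l-1  = natCast≈⇒%≡ (begin
    natCast (multiplicity js k)
      ≈⟨ natCast-[p-1]* (multiplicity js k) _ ⟨
    natCast (multiplicity js k ℕ.+ (p ∸ 1) ℕ.* a) + natCast a
      ≡⟨ ≡.cong (λ n → natCast n + natCast a) (reduced-block js t r r<d) ⟨
    natCast (reduced js k) + natCast a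
      ≈⟨ +-congʳ (powers-independent (reduced js) ∑≈0′ k k<D) ⟩
    0# + natCast a
      ≈⟨ +-identityˡ _ ⟩
    natCast a
      ∎)
    where
    k = t ℕ.* d ℕ.+ r
    a = multiplicity js (D ℕ.+ r)
    ∑≈0′ : ∑[ k < D ] (natCast (reduced js k) * ζ ^ k) ≈ 0#
    ∑≈0′ = trans (∑-reduced js js<m) ∑≈0
    k<D : k < D
    k<D = ℕₚ.<-≤-trans (ℕₚ.+-monoʳ-< (t ℕ.* d) r<d)
                       (≡.subst (_≤ D) (ℕₚ.+-comm d (t ℕ.* d)) (ℕₚ.*-monoˡ-≤ d t<l-1))

  vanishing-sum-length : ∀ js → All (_< m) js → sumPowers js ≈ 0# →
                         ∃₂ λ b c → length js ≡ b ℕ.* p ℕ.+ c ℕ.* l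
  vanishing-sum-length js js<m ∑≈0 =
    let b , c , ∑≡bp+cl = ∑-blockwise-congruent l d (multiplicity js) (λ r → multiplicity js (D ℕ.+ r) % p)
                                                (multiplicity-periodic js js<m ∑≈0)
    in b , c , ≡.trans (length≡∑multiplicity m js js<m) ∑≡bp+cl

  -- Equality in K is undecidable, so the exponents exist only under double negation;
  -- the theorem removes it with the decidability of ∈ℕp+ℕl?.
  exponents : ∀ n (α : Fin n → Carrier) → (∀ i → α i ^ m ≈ 1#) →
              ¬ ¬ (Σ (List ℕ) λ js → All (_< m) js × length js ≡ n × sumF n α ≈ sumPowers js)
  exponents zero    α _       found = found ([] , [] , ≡.refl , refl)
  exponents (suc n) α α-roots found =
    root-of-unity⇒power (α Fin.zero) (α-roots Fin.zero) λ j j<m α₀≈ζʲ →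
      exponents n (α ∘ Fin.suc) (α-roots ∘ Fin.suc) λ { (js , js<m , length≡n , ∑α≈ζ^js) →
        found (j ∷ js , j<m ∷ js<m , ≡.cong suc length≡n , +-cong α₀≈ζʲ ∑α≈ζ^js) }

  InW⇒∈ℕp+ℕl : ∀ n → InW K m n → ¬ ¬ (∃₂ λ b c → n ≡ b ℕ.* p ℕ.+ c ℕ.* l)
  InW⇒∈ℕp+ℕl n (α , α-roots , ∑α≈0) found =
    exponents n α α^m≈1 λ { (js , js<m , length≡n , ∑α≈ζ^js) →
      let b , c , length≡bp+cl = vanishing-sum-length js js<m (trans (sym ∑α≈ζ^js) ∑α≈0)
      in found (b , c , ≡.trans (≡.sym length≡n) length≡bp+cl) }
    where
    α^m≈1 : ∀ i → α i ^ m ≈ 1#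
    α^m≈1 i = trans (reflexive (≡.sym (pow≡^ (α i) m))) (α-roots i)

  InW-p : InW K m p
  InW-p = (λ _ → 1#) , (λ _ → trans (reflexive (pow≡^ 1# m)) (1^n≈1 m)) , trans (reflexive (sumF-ones p)) characteristic
    where
    sumF-ones : ∀ n → sumF n (λ _ → 1#) ≡ natCast n
    sumF-ones zero    = ≡.refl
    sumF-ones (suc n) = ≡.cong (1# +_) (sumF-ones n)

  InW-l : InW K m l
  InW-l = (λ i → η ^ Fin.toℕ i) , roots , trans (sumF≈∑ l (η ^_)) geo-η
    where
    η^m≈1 : η ^ m ≈ 1#
    η^m≈1 = trans (sym (^-assocʳ η l d)) (trans (^-congˡ d η^l≈1) (1^n≈1 d))
    roots : ∀ i → pow (η ^ Fin.toℕ i) m ≈ 1#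
    roots i = trans (reflexive (pow≡^ _ m)) (^-^≈1 (Fin.toℕ i) m η^m≈1)

  ℕp+ℕl⇒InW : ∀ b c → InW K m (b ℕ.* p ℕ.+ c ℕ.* l)
  ℕp+ℕl⇒InW b c = InW-+ m (InW-* m InW-p b) (InW-* m InW-l c)

open import Data.Nat using (_+_; _*_; _^_)

theorem2p6 : ∀ {c ℓ′ : Level} (K : Field c ℓ′) (p l a : ℕ) →
    Prime p → Prime l → p ≢ l → 1 ≤ a →
    IsAlgebraicClosureOfFp p K →
    IrreducibleMod p (cyclotomicPrimePower l a) →
    ∀ n → (InW K (l ^ a) n ⇔ ∃₂ λ b c → n ≡ b * p + c * l)
theorem2p6 K p l (suc a′) p-prime l-prime p≢l (s≤s z≤n) closure Φ-irreducible n =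
  mk⇔ (λ n∈W → decidable-stable (∈ℕp+ℕl? p l n) (InW⇒∈ℕp+ℕl n n∈W))
      (λ { (b , c , ≡.refl) → ℕp+ℕl⇒InW b c })
  where
  open SumsOfRootsOfUnity K p-prime closure l-prime p≢l a′ Φ-irreducible
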